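{- For every $\alpha = (\alpha_1,\dots,\alpha_m) \in \mathbb{Z}^m$, \[ \mathfrak{S}_\alpha = \sum_{\sigma \in S_m} (-1)^{\sigma}\, H_{\alpha_1+\sigma_1-1}\, H_{\alpha_2+\sigma_2-2}\cdots H_{\alpha_m+\sigma_m-m}, \] with the conventions $H_0=1$ and $H_{ -r}=0$ for $r>0$, where $(-1)^\sigma$ is the sign of the permutation $\sigma$.
   Context: Work over $\mathbb{Q}$. $\mathrm{NSym}$ is the free associative graded algebra on generators $H_1,H_2,\dots$ ($H_i$ of degree $i$), with $H_0=1$, $H_{ -r}=0$ for $r>0$. Its graded dual is $\mathrm{QSym}$ (quasisymmetric functions) via the pairing $\langle H_{\alpha_1}\cdots H_{\alpha_k}, M_\beta\rangle=\delta_{\alpha\beta}$, where $M_\beta=\sum_{i_1<\dots<i_k}x_{i_1}^{\beta_1}\cdots x_{i_k}^{\beta_k}$; the coproduct of $\mathrm{NSym}$ is $\Delta(H_j)=\sum_{i=0}^j H_i\otimes H_{j-i}$, extended multiplicatively. For $F\in\mathrm{QSym}$, $F^\perp$ is the adjoint of multiplication by $F$: $\langle F^\perp(H),G\rangle=\langle H,FG\rangle$. $F_{1^i}$ is the fundamental quasisymmetric function indexed by the composition $(1^i)$, i.e. $F_{1^i}=M_{1^i}$, $F_{1^0}=1$. For $m\in\mathbb{Z}$, $\mathbb{B}_m=\sum_{i\ge0}(-1)^iH_{m+i}F_{1^i}^\perp$, and for $\alpha\in\mathbb{Z}^m$, $\mathfrak{S}_\alpha=\mathbb{B}_{\alpha_1}\cdots\mathbb{B}_{\alpha_m}(1)$.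 -}

module Defs where

open import Data.Bool using (Bool; true; false; not; _∧_; if_then_else_)
open import Data.Nat as ℕ using (ℕ; zero; suc; _≡ᵇ_; _<ᵇ_)
open import Data.Integer as ℤ using (ℤ; +_; -[1+_]; ∣_∣)
open import Data.Rational as ℚ using (ℚ; 0ℚ; 1ℚ)
open import Data.List using (List; []; _∷_; map; _++_; concatMap; filterᵇ; length; foldr; replicate)
open import Data.Nat.ListAction using (sum)
open import Data.Bool.ListAction using (any)
open import Data.List.Properties using (≡-dec)
open import Data.Vec using (Vec; toList)
open import Data.Product using (_×_; _,_)
open import Relation.Nullary using (does)
open import Data.List.Relation.Unary.All using (All)

sumℚ : List ℚ → ℚ
sumℚ = foldr ℚ._+_ 0ℚ

sgn : ℕ → ℚ
sgn zero    = 1ℚ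
sgn (suc n) = ℚ.- sgn n

eqList : List ℕ → List ℕ → Bool
eqList a b = does (≡-dec ℕ._≟_ a b)

range : ℕ → ℕ → List ℕ
range a zero    = []
range a (suc k) = a ∷ range (suc a) k

IsComposition : List ℕ → Set
IsComposition = All (ℕ._<_ 0)

-- A word H_{γ1} H_{γ2} ⋯ H_{γk} (γ a composition) is the
-- basis element indexed by the list γ; an element is given by its
-- coefficient function.  (Lists containing a 0 entry are junk indices.)

NSym : Set
NSym = List ℕ → ℚ

_≈N_ : NSym → NSym → Set
x ≈N y = ∀ γ → IsComposition γ → x γ ≡ y γ
  where open import Relation.Binary.PropositionalEquality using (_≡_)

zeroN : NSym
zeroN _ = 0ℚ

oneN : NSym
oneN []      = 1ℚ
oneN (_ ∷ _) = 0ℚ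

_+N_ : NSym → NSym → NSym
(x +N y) γ = x γ ℚ.+ y γ

_•N_ : ℚ → NSym → NSym
(c •N x) γ = c ℚ.* x γ

splits : List ℕ → List (List ℕ × List ℕ)
splits []      = ([] , []) ∷ []
splits (a ∷ γ) = ([] , a ∷ γ) ∷ map (λ { (p , q) → (a ∷ p , q) }) (splits γ)

-- multiplication (concatenation of words, extended bilinearly)
_·N_ : NSym → NSym → NSym
(x ·N y) γ = sumℚ (map (λ { (p , q) → x p ℚ.* y q }) (splits γ))

H : ℤ → NSym
H (+ zero)    = oneN
H (+ suc k) γ = if eqList γ (suc k ∷ []) then 1ℚ else 0ℚ
H -[1+ _ ]    = zeroN

-- QSym, realised inside formal power series in x1, x2, ... .
-- A monomial x1^{e1} ⋯ xk^{ek} is the exponent list e (trailing zeros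
-- are irrelevant); a series is its coefficient function.

Series : Set
Series = List ℕ → ℚ

M : List ℕ → Series
M β e = if eqList (filterᵇ (λ k → not (k ≡ᵇ 0)) e) β then 1ℚ else 0ℚ

decomp : List ℕ → List (List ℕ × List ℕ)
decomp []      = ([] , []) ∷ []
decomp (a ∷ e) =
  concatMap (λ k → map (λ { (p , q) → (k ∷ p , (a ℕ.∸ k) ∷ q) }) (decomp e))
            (range 0 (suc a))

_⋆_ : Series → Series → Series
(F ⋆ G) e = sumℚ (map (λ { (p , q) → F p ℚ.* G q }) (decomp e))

-- F_{1^i} = M_{1^i}
F1 : ℕ → Series
F1 i = M (replicate i 1)

-- the pairing ⟨H_α , G⟩ = coefficient of M_α in the quasisymmetric G,
-- i.e. the coefficient of the monomial x1^{α1} ⋯ xk^{αk}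
pairH : List ℕ → Series → ℚ
pairH α G = G α

incHead : List ℕ → List ℕ
incHead []      = []
incHead (a ∷ r) = suc a ∷ r

compositions : ℕ → List (List ℕ)
compositions zero          = [] ∷ []
compositions (suc zero)    = (1 ∷ []) ∷ []
compositions (suc (suc n)) =
  map (1 ∷_) (compositions (suc n)) ++ map incHead (compositions (suc n))

-- F_{1^i}^⊥ : adjoint of multiplication by F_{1^i}.  Its coefficient on
-- H_β is ⟨F_{1^i}^⊥ x , M_β⟩ = ⟨x , F_{1^i} M_β⟩ = Σ_α x_α ⟨H_α , F_{1^i} M_β⟩,
-- where only α with |α| = i + |β| can contribute (F_{1^i} M_β is
-- homogeneous of that degree).
F1perp : ℕ → NSym → NSym
F1perp i x β =
  sumℚ (map (λ α → x α ℚ.* pairH α (F1 i ⋆ M β)) (compositions (i ℕ.+ sum β)))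

-- 𝔹_m = Σ_{i≥0} (-1)^i H_{m+i} F_{1^i}^⊥ .  On the coefficient of H_γ only
-- terms with m + i ≤ |γ| can be nonzero (H_{m+i} · y has all its words
-- starting with the letter m+i when m+i>0), so the sum is truncated at
-- i ≤ | |γ| - m |, which includes all possibly nonzero terms.
B : ℤ → NSym → NSym
B m x γ =
  sumℚ (map (λ i → sgn i ℚ.* (H (m ℤ.+ + i) ·N F1perp i x) γ)
            (range 0 (suc ∣ + sum γ ℤ.- m ∣)))

𝔖 : ∀ {m} → Vec ℤ m → NSym
𝔖 α = foldr B oneN (toList α)

seqs : ℕ → ℕ → List (List ℕ)
seqs m zero    = [] ∷ []
seqs m (suc k) = concatMap (λ s → map (s ∷_) (seqs m k)) (range 1 m)

distinct : List ℕ → Bool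
distinct []       = true
distinct (x ∷ xs) = not (any (x ≡ᵇ_) xs) ∧ distinct xs

permutations : ℕ → List (List ℕ)
permutations m = filterᵇ distinct (seqs m m)

inversions : List ℕ → ℕ
inversions []       = 0
inversions (x ∷ xs) = length (filterᵇ (_<ᵇ x) xs) ℕ.+ inversions xs

sign : List ℕ → ℚ
sign σ = sgn (inversions σ)

Hterm : ℕ → List ℤ → List ℕ → NSym
Hterm j (a ∷ as) (s ∷ ss) = H (a ℤ.+ + s ℤ.- + j) ·N Hterm (suc j) as ss
Hterm j _        _        = oneN

detH : ∀ {m} → Vec ℤ m → NSym
detH {m} α =
  foldr (λ σ acc → (sign σ •N Hterm 1 (toList α) σ) +N acc) zeroN (permutations m)

-- Both sides are the determinant of (H_{α_i - i + j}), written as an alternating sum det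
-- over bijections and expanded along the first row. The key fact is the Leibniz rule
-- F_{1^i}^⊥ (H_x Y) = H_x F_{1^i}^⊥ Y + H_{x-1} F_{1^{i-1}}^⊥ Y, which holds because F_{1^i}
-- is squarefree; it makes F_{1^i}^⊥ lower i distinct letters of a word H_{w₁} ⋯ H_{w_k}
-- by one, hence lower i columns of a determinant. By induction on m, 𝔖 of the tail of α is
-- a determinant with consecutive columns, which is alternating, so only lowering its first
-- i columns survives; the signed sum over i defining 𝔹_{α₁} is then exactly the first-row
-- expansion. On the other side, the sign of a permutation is computed one letter at a time,
-- which is the same first-row expansion.

module Submission where

open import Defs
open import Data.Bool using (Bool; true; false; not; _∧_; _∨_; if_then_else_; T)
open import Algebra.Bundles using (CommutativeMonoid)
import Algebra.Properties.CommutativeSemigroup as CommutativeSemigroupProperties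
open import Data.Bool.Properties using (∧-zeroʳ; ∧-identityʳ; ∧-commutativeMonoid)
open import Data.Bool.ListAction using (any)
open import Data.Empty using (⊥-elim)
open import Data.Integer as ℤ using (ℤ; +_; -[1+_]; ∣_∣; 1ℤ)
import Data.Integer.Properties as ℤ
import Data.Integer.Solver
open import Data.List using (List; []; _∷_; map; _++_; concatMap; foldr; length; filterᵇ; zipWith)
open import Data.List.Membership.Propositional using (_∈_)
open import Data.List.Relation.Unary.All as All using (All; []; _∷_)
import Data.List.Relation.Unary.All.Properties as All
open import Data.List.Relation.Unary.Any using (here; there)
open import Data.List.Relation.Unary.AllPairs using (AllPairs; []; _∷_)
import Data.List.Relation.Unary.AllPairs.Properties as AllPairs
open import Data.Nat as ℕ using (ℕ; zero; suc; z≤n; s≤s; _≡ᵇ_; _<ᵇ_)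
import Data.Nat.Properties as ℕ
open import Data.Nat.ListAction using (sum)
import Data.Nat.Solver
open import Data.Product using (_×_; _,_)
open import Data.Rational using (ℚ; 0ℚ; 1ℚ; _+_; _*_; -_; _-_)
import Data.Rational.Properties as ℚ
import Data.Rational.Solver
open import Data.Unit using (tt)
open import Function using (_∘_)
open import Data.Vec using (Vec; toList) renaming ([] to []ᵥ; _∷_ to _∷ᵥ_)
open import Data.Vec.Properties using (length-toList)
open import Relation.Binary.PropositionalEquality
open import Relation.Nullary using (yes; no)
open import Relation.Nullary.Decidable using (T?)

open ≡-Reasoning

module ℚ-Solver = Data.Rational.Solver.+-*-Solver
module ℤ-Solver = Data.Integer.Solver.+-*-Solver
module ℕ-Solver = Data.Nat.Solver.+-*-Solver

private variable I K : Set

𝟙 : Bool → ℚ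
𝟙 b = if b then 1ℚ else 0ℚ

∑ : List I → (I → ℚ) → ℚ
∑ xs f = sumℚ (map f xs)

infix 2 ∑
syntax ∑ xs (λ x → e) = ∑[ x ∈ xs ] e

∑-cong : ∀ xs {f g : I → ℚ} → (∀ x → f x ≡ g x) → ∑ xs f ≡ ∑ xs g
∑-cong []       f≗g = refl
∑-cong (x ∷ xs) f≗g = cong₂ _+_ (f≗g x) (∑-cong xs f≗g)

∑-cong-All : ∀ {P : I → Set} xs {f g : I → ℚ} → All P xs →
             (∀ x → P x → f x ≡ g x) → ∑ xs f ≡ ∑ xs g
∑-cong-All []       []         f≗g = refl
∑-cong-All (x ∷ xs) (px ∷ pxs) f≗g = cong₂ _+_ (f≗g x px) (∑-cong-All xs pxs f≗g)

∑-zero : ∀ xs {f : I → ℚ} → (∀ x → f x ≡ 0ℚ) → ∑ xs f ≡ 0ℚ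
∑-zero []       f≗0 = refl
∑-zero (x ∷ xs) f≗0 = trans (cong₂ _+_ (f≗0 x) (∑-zero xs f≗0)) (ℚ.+-identityˡ 0ℚ)

∑-++ : ∀ xs ys (f : I → ℚ) → ∑ (xs ++ ys) f ≡ ∑ xs f + ∑ ys f
∑-++ []       ys f = sym (ℚ.+-identityˡ _)
∑-++ (x ∷ xs) ys f = trans (cong (_+_ (f x)) (∑-++ xs ys f)) (sym (ℚ.+-assoc (f x) _ _))

+-interchange : ∀ a b c d → (a + b) + (c + d) ≡ (a + c) + (b + d)
+-interchange = solve 4 (λ a b c d → (a :+ b) :+ (c :+ d) := (a :+ c) :+ (b :+ d)) refl
  where open ℚ-Solver

∑-+ : ∀ xs (f g : I → ℚ) → (∑[ x ∈ xs ] (f x + g x)) ≡ ∑ xs f + ∑ xs g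
∑-+ []       f g = sym (ℚ.+-identityˡ 0ℚ)
∑-+ (x ∷ xs) f g = trans (cong (_+_ (f x + g x)) (∑-+ xs f g))
                         (+-interchange (f x) (g x) (∑ xs f) (∑ xs g))

∑-*ˡ : ∀ xs c (f : I → ℚ) → (∑[ x ∈ xs ] (c * f x)) ≡ c * ∑ xs f
∑-*ˡ []       c f = sym (ℚ.*-zeroʳ c)
∑-*ˡ (x ∷ xs) c f = trans (cong (_+_ (c * f x)) (∑-*ˡ xs c f)) (sym (ℚ.*-distribˡ-+ c (f x) _))

∑-neg : ∀ xs (f : I → ℚ) → (∑[ x ∈ xs ] (- f x)) ≡ - ∑ xs f
∑-neg []       f = refl
∑-neg (x ∷ xs) f = trans (cong (_+_ (- f x)) (∑-neg xs f)) (sym (ℚ.neg-distrib-+ (f x) _))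

∑-minus : ∀ xs (f g : I → ℚ) → (∑[ x ∈ xs ] (f x - g x)) ≡ ∑ xs f - ∑ xs g
∑-minus xs f g = trans (∑-+ xs f (λ x → - g x)) (cong (_+_ (∑ xs f)) (∑-neg xs g))

∑-filterᵇ : ∀ (p : I → Bool) xs (f : I → ℚ) →
            ∑ (filterᵇ p xs) f ≡ (∑[ x ∈ xs ] (𝟙 (p x) * f x))
∑-filterᵇ p []       f = refl
∑-filterᵇ p (x ∷ xs) f with p x
... | true  = cong₂ _+_ (sym (ℚ.*-identityˡ (f x))) (∑-filterᵇ p xs f)
... | false = trans (sym (ℚ.+-identityˡ _)) (cong₂ _+_ (sym (ℚ.*-zeroˡ (f x))) (∑-filterᵇ p xs f))

∑-map : ∀ xs (g : I → K) (f : K → ℚ) → ∑ (map g xs) f ≡ (∑[ x ∈ xs ] f (g x))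
∑-map []       g f = refl
∑-map (x ∷ xs) g f = cong (_+_ (f (g x))) (∑-map xs g f)

∑-map-++ : ∀ xs ys (g h : I → K) (f : K → ℚ) →
           ∑ (map g xs ++ map h ys) f ≡ (∑[ x ∈ xs ] f (g x)) + (∑[ y ∈ ys ] f (h y))
∑-map-++ xs ys g h f = trans (∑-++ (map g xs) (map h ys) f) (cong₂ _+_ (∑-map xs g f) (∑-map ys h f))

∑-concatMap : ∀ xs (g : I → List K) (f : K → ℚ) →
              ∑ (concatMap g xs) f ≡ (∑[ x ∈ xs ] ∑ (g x) f)
∑-concatMap []       g f = refl
∑-concatMap (x ∷ xs) g f =
  trans (∑-++ (g x) (concatMap g xs) f) (cong (_+_ (∑ (g x) f)) (∑-concatMap xs g f))

∑-comm : ∀ xs ys (f : I → K → ℚ) →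
         (∑[ x ∈ xs ] ∑[ y ∈ ys ] f x y) ≡ (∑[ y ∈ ys ] ∑[ x ∈ xs ] f x y)
∑-comm []       ys f = sym (∑-zero ys (λ _ → refl))
∑-comm (x ∷ xs) ys f = trans (cong (_+_ (∑ ys (f x))) (∑-comm xs ys f))
                             (sym (∑-+ ys (f x) (λ y → ∑[ x ∈ xs ] f x y)))

-- expand C f = Σₖ (-1)ᵏ f Cₖ (C with Cₖ deleted): Laplace expansion along one row.
expand : List ℤ → (ℤ → List ℤ → ℚ) → ℚ
expand []      f = 0ℚ
expand (c ∷ C) f = f c C - expand C (λ c′ R → f c′ (c ∷ R))

-- det β C φ = Σ_σ sgn σ · φ (β₁ + C_σ₁ , … , βₙ + C_σₙ); for φ w = H_w₁ ⋯ H_wₙ this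
-- is the determinant of the matrix (H_{βᵢ + Cⱼ}).
det : List ℤ → List ℤ → (List ℤ → ℚ) → ℚ
det []      []      φ = φ []
det []      (_ ∷ _) φ = 0ℚ
det (b ∷ β) C       φ = expand C (λ c R → det β R (λ w → φ ((b ℤ.+ c) ∷ w)))

expand-cong : ∀ C {f g : ℤ → List ℤ → ℚ} → (∀ c R → f c R ≡ g c R) → expand C f ≡ expand C g
expand-cong []      f≗g = refl
expand-cong (c ∷ C) f≗g = cong₂ _-_ (f≗g c C) (expand-cong C (λ c′ R → f≗g c′ (c ∷ R)))

expand-zero : ∀ C {f : ℤ → List ℤ → ℚ} → (∀ c R → f c R ≡ 0ℚ) → expand C f ≡ 0ℚ
expand-zero []      f≗0 = refl
expand-zero (c ∷ C) f≗0 = cong₂ _-_ (f≗0 c C) (expand-zero C (λ c′ R → f≗0 c′ (c ∷ R)))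

expand-+ : ∀ C (f g : ℤ → List ℤ → ℚ) →
           expand C (λ c R → f c R + g c R) ≡ expand C f + expand C g
expand-+ []      f g = refl
expand-+ (c ∷ C) f g =
  trans (cong (λ x → (f c C + g c C) - x) (expand-+ C (λ c′ R → f c′ (c ∷ R)) (λ c′ R → g c′ (c ∷ R))))
        (minus-interchange (f c C) _ (g c C) _)
  where
  open ℚ-Solver
  minus-interchange : ∀ a b c d → (a + c) - (b + d) ≡ (a - b) + (c - d)
  minus-interchange = solve 4 (λ a b c d → (a :+ c) :- (b :+ d) := (a :- b) :+ (c :- d)) refl

expand-*ˡ : ∀ C k (f : ℤ → List ℤ → ℚ) → expand C (λ c R → k * f c R) ≡ k * expand C f
expand-*ˡ []      k f = sym (ℚ.*-zeroʳ k)
expand-*ˡ (c ∷ C) k f =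
  trans (cong (λ x → k * f c C - x) (expand-*ˡ C k (λ c′ R → f c′ (c ∷ R))))
        (solve 3 (λ k a b → k :* a :- k :* b := k :* (a :- b)) refl k (f c C) _)
  where open ℚ-Solver

expand-map : ∀ (g : ℤ → ℤ) C (f : ℤ → List ℤ → ℚ) →
             expand (map g C) f ≡ expand C (λ c R → f (g c) (map g R))
expand-map g []      f = refl
expand-map g (c ∷ C) f = cong (_-_ (f (g c) (map g C))) (expand-map g C (λ c′ R → f c′ (g c ∷ R)))

det-cong : ∀ β C {φ ψ : List ℤ → ℚ} → (∀ w → φ w ≡ ψ w) → det β C φ ≡ det β C ψ
det-cong []      []      φ≗ψ = φ≗ψ []
det-cong []      (_ ∷ _) φ≗ψ = refl
det-cong (b ∷ β) C       φ≗ψ = expand-cong C (λ c R → det-cong β R (λ w → φ≗ψ _))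

det-zero : ∀ β C {φ : List ℤ → ℚ} → (∀ w → φ w ≡ 0ℚ) → det β C φ ≡ 0ℚ
det-zero []      []      φ≗0 = φ≗0 []
det-zero []      (_ ∷ _) φ≗0 = refl
det-zero (b ∷ β) C       φ≗0 = expand-zero C (λ c R → det-zero β R (λ w → φ≗0 _))

det-+ : ∀ β C (φ ψ : List ℤ → ℚ) → det β C (λ w → φ w + ψ w) ≡ det β C φ + det β C ψ
det-+ []      []      φ ψ = refl
det-+ []      (_ ∷ _) φ ψ = sym (ℚ.+-identityˡ 0ℚ)
det-+ (b ∷ β) C       φ ψ = trans (expand-cong C (λ c R → det-+ β R _ _)) (expand-+ C _ _)

det-*ˡ : ∀ β C k (φ : List ℤ → ℚ) → det β C (λ w → k * φ w) ≡ k * det β C φ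
det-*ˡ []      []      k φ = refl
det-*ˡ []      (_ ∷ _) k φ = sym (ℚ.*-zeroʳ k)
det-*ˡ (b ∷ β) C       k φ = trans (expand-cong C (λ c R → det-*ˡ β R k _)) (expand-*ˡ C k _)

det-∑ : ∀ β C (xs : List I) (φ : I → List ℤ → ℚ) →
        det β C (λ w → ∑[ x ∈ xs ] φ x w) ≡ (∑[ x ∈ xs ] det β C (φ x))
det-∑ β C []       φ = det-zero β C (λ w → refl)
det-∑ β C (x ∷ xs) φ = trans (det-+ β C (φ x) _) (cong (_+_ (det β C (φ x))) (det-∑ β C xs φ))

lowerings : ℕ → List ℤ → List (List ℤ)
lowerings zero    C       = C ∷ []
lowerings (suc i) []      = []
lowerings (suc i) (x ∷ C) = map (x ∷_) (lowerings (suc i) C) ++ map ((x ℤ.- 1ℤ) ∷_) (lowerings i C)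

lowerings⁻ : ℕ → List ℤ → List (List ℤ)
lowerings⁻ zero    C = []
lowerings⁻ (suc i) C = lowerings i C

∑-lowerings-∷ : ∀ i x C (F : List ℤ → ℚ) →
  ∑ (lowerings i (x ∷ C)) F ≡
  (∑[ D ∈ lowerings i C ] F (x ∷ D)) + (∑[ D ∈ lowerings⁻ i C ] F ((x ℤ.- 1ℤ) ∷ D))
∑-lowerings-∷ zero    x C F = ∑-map-++ (C ∷ []) [] (x ∷_) ((x ℤ.- 1ℤ) ∷_) F
∑-lowerings-∷ (suc i) x C F = ∑-map-++ (lowerings (suc i) C) (lowerings i C) (x ∷_) ((x ℤ.- 1ℤ) ∷_) F

lowerings-empty : ∀ i C → length C ℕ.< i → lowerings i C ≡ []
lowerings-empty (suc i) []      _         = refl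
lowerings-empty (suc i) (x ∷ C) (s≤s |C|<i) =
  cong₂ (λ L L′ → map (x ∷_) L ++ map ((x ℤ.- 1ℤ) ∷_) L′)
        (lowerings-empty (suc i) C (ℕ.m<n⇒m<1+n |C|<i)) (lowerings-empty i C |C|<i)

∑-lowerings-expand : ∀ C i (f : ℤ → List ℤ → ℚ) →
  (∑[ D ∈ lowerings i C ] expand D f) ≡
  expand C (λ c R → ∑ (lowerings i R) (f c) + ∑ (lowerings⁻ i R) (f (c ℤ.- 1ℤ)))
∑-lowerings-expand []      zero    f = ℚ.+-identityʳ 0ℚ
∑-lowerings-expand []      (suc i) f = refl
∑-lowerings-expand (x ∷ C) zero    f =
  trans (ℚ.+-identityʳ _) (expand-cong (x ∷ C) {f} (λ c R → sym (trans (ℚ.+-identityʳ _) (ℚ.+-identityʳ _))))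
∑-lowerings-expand (x ∷ C) (suc i) f = begin
  ∑ (lowerings (suc i) (x ∷ C)) (λ D → expand D f)
    ≡⟨ ∑-lowerings-∷ (suc i) x C (λ D → expand D f) ⟩
  (∑[ D ∈ lowerings (suc i) C ] (f x D - expand D fₓ)) + (∑[ D ∈ lowerings i C ] (f x′ D - expand D fₓ′))
    ≡⟨ cong₂ _+_ (∑-minus (lowerings (suc i) C) (f x) _) (∑-minus (lowerings i C) (f x′) _) ⟩
  (a - (∑[ D ∈ lowerings (suc i) C ] expand D fₓ)) + (a′ - (∑[ D ∈ lowerings i C ] expand D fₓ′))
    ≡⟨ cong₂ (λ u v → (a - u) + (a′ - v)) (∑-lowerings-expand C (suc i) fₓ) (∑-lowerings-expand C i fₓ′) ⟩
  (a - expand C h₁) + (a′ - expand C h₂)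
    ≡⟨ solve 4 (λ a e₁ a′ e₂ → (a :- e₁) :+ (a′ :- e₂) := (a :+ a′) :- (e₁ :+ e₂)) refl a _ a′ _ ⟩
  (a + a′) - (expand C h₁ + expand C h₂)
    ≡⟨ cong (_-_ (a + a′)) (sym (expand-+ C h₁ h₂)) ⟩
  (a + a′) - expand C (λ c R → h₁ c R + h₂ c R)
    ≡⟨ cong (_-_ (a + a′)) (expand-cong C h₁+h₂) ⟩
  expand (x ∷ C) h ∎
  where
  open ℚ-Solver using (solve; _:+_; _:-_; _:=_)
  x′ = x ℤ.- 1ℤ
  fₓ fₓ′ h h₁ h₂ : ℤ → List ℤ → ℚ
  fₓ  c R = f c (x ∷ R)
  fₓ′ c R = f c (x′ ∷ R)
  h  c R = ∑ (lowerings (suc i) R) (f c) + ∑ (lowerings i R) (f (c ℤ.- 1ℤ))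
  h₁ c R = ∑ (lowerings (suc i) R) (fₓ c) + ∑ (lowerings i R) (fₓ (c ℤ.- 1ℤ))
  h₂ c R = ∑ (lowerings i R) (fₓ′ c) + ∑ (lowerings⁻ i R) (fₓ′ (c ℤ.- 1ℤ))
  a  = ∑ (lowerings (suc i) C) (f x)
  a′ = ∑ (lowerings i C) (f x′)
  h₁+h₂ : ∀ c R → h₁ c R + h₂ c R ≡ h c (x ∷ R)
  h₁+h₂ c R = sym (trans (cong₂ _+_ (∑-lowerings-∷ (suc i) x R (f c)) (∑-lowerings-∷ i x R (f (c ℤ.- 1ℤ))))
                         (+-interchange (∑ (lowerings (suc i) R) (fₓ c)) (∑ (lowerings i R) (fₓ′ c)) _ _))

-- Lowering a column of C lowers the corresponding entries βᵢ + Cⱼ.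
det-∑-lowerings : ∀ β C i (φ : List ℤ → ℚ) →
  det β C (λ w → ∑ (lowerings i w) φ) ≡ (∑[ D ∈ lowerings i C ] det β D φ)
det-∑-lowerings⁻ : ∀ β C i (φ : List ℤ → ℚ) →
  det β C (λ w → ∑ (lowerings⁻ i w) φ) ≡ (∑[ D ∈ lowerings⁻ i C ] det β D φ)
det-∑-lowerings⁻ β C zero    φ = det-zero β C (λ w → refl)
det-∑-lowerings⁻ β C (suc i) φ = det-∑-lowerings β C i φ
det-∑-lowerings []      []      zero    φ = refl
det-∑-lowerings []      []      (suc i) φ = refl
det-∑-lowerings []      (x ∷ C) i       φ = sym (trans (∑-lowerings-∷ i x C (λ D → det [] D φ))
  (trans (cong₂ _+_ (∑-zero (lowerings i C) (λ _ → refl)) (∑-zero (lowerings⁻ i C) (λ _ → refl)))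
         (ℚ.+-identityˡ 0ℚ)))
det-∑-lowerings (b ∷ β) C       i       φ = begin
  expand C (λ c R → det β R (λ w → ∑ (lowerings i ((b ℤ.+ c) ∷ w)) φ))
    ≡⟨ expand-cong C (λ c R → trans (det-cong β R (λ w → ∑-lowerings-∷ i (b ℤ.+ c) w φ))
                        (trans (det-+ β R _ _) (cong₂ _+_ (det-∑-lowerings β R i _) (det-∑-lowerings⁻ β R i _)))) ⟩
  expand C (λ c R → (∑[ D ∈ lowerings i R ] det β D (φ₁ c)) + (∑[ D ∈ lowerings⁻ i R ] det β D (φ₂ c)))
    ≡⟨ expand-cong C (λ c R → cong (_+_ (∑[ D ∈ lowerings i R ] det β D (φ₁ c)))
          (∑-cong (lowerings⁻ i R) (λ D → det-cong β D (λ w → cong (λ t → φ (t ∷ w)) (lowered-entry c))))) ⟩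
  expand C (λ c R → ∑ (lowerings i R) (f c) + ∑ (lowerings⁻ i R) (f (c ℤ.- 1ℤ)))
    ≡⟨ sym (∑-lowerings-expand C i f) ⟩
  (∑[ D ∈ lowerings i C ] expand D f) ∎
  where
  φ₁ φ₂ : ℤ → List ℤ → ℚ
  φ₁ c w = φ ((b ℤ.+ c) ∷ w)
  φ₂ c w = φ (((b ℤ.+ c) ℤ.- 1ℤ) ∷ w)
  f : ℤ → List ℤ → ℚ
  f c R = det β R (φ₁ c)
  lowered-entry : ∀ c → (b ℤ.+ c) ℤ.- 1ℤ ≡ b ℤ.+ (c ℤ.- 1ℤ)
  lowered-entry c = ℤ.+-assoc b c (ℤ.- 1ℤ)

data AdjacentRepeat : List ℤ → Set where
  adjacent : ∀ {x C} → AdjacentRepeat (x ∷ x ∷ C)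
  skip     : ∀ {x C} → AdjacentRepeat C → AdjacentRepeat (x ∷ C)

Alternating : (List ℤ → ℚ) → Set
Alternating g = ∀ D → AdjacentRepeat D → g D ≡ 0ℚ

expand-repeat : ∀ C (f : ℤ → List ℤ → ℚ) → (∀ c → Alternating (f c)) → AdjacentRepeat C → expand C f ≡ 0ℚ
expand-repeat (x ∷ x ∷ C) f alt adjacent =
  trans (solve 2 (λ a e → a :- (a :- e) := e) refl (f x (x ∷ C)) _)
        (expand-zero C (λ c R → alt c (x ∷ x ∷ R) adjacent))
  where open ℚ-Solver
expand-repeat (x ∷ C) f alt (skip rep) =
  cong₂ _-_ (alt x C rep) (expand-repeat C _ (λ c D r → alt c (x ∷ D) (skip r)) rep)

det-alternating : ∀ β C (φ : List ℤ → ℚ) → AdjacentRepeat C → det β C φ ≡ 0ℚ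
det-alternating []      (_ ∷ _) φ rep = refl
det-alternating (b ∷ β) C       φ rep = expand-repeat C _ (λ c R r → det-alternating β R _ r) rep

consecutive : ℤ → ℕ → List ℤ
consecutive s zero    = []
consecutive s (suc m) = s ∷ consecutive (s ℤ.+ 1ℤ) m

lowerFirst : ℕ → ℤ → ℕ → List ℤ
lowerFirst zero    s m       = consecutive s m
lowerFirst (suc i) s zero    = []
lowerFirst (suc i) s (suc m) = (s ℤ.- 1ℤ) ∷ lowerFirst i (s ℤ.+ 1ℤ) m

length-consecutive : ∀ s m → length (consecutive s m) ≡ m
length-consecutive s zero    = refl
length-consecutive s (suc m) = cong suc (length-consecutive _ m)

+1-1 : ∀ s → (s ℤ.+ 1ℤ) ℤ.- 1ℤ ≡ s
+1-1 = solve 1 (λ s → (s :+ con 1ℤ) :- con 1ℤ := s) refl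
  where open ℤ-Solver

-- Lowering s + k + 1 while keeping s + k creates the repeat s + k, s + k, so for an
-- alternating g only the lowering of the first i entries survives.
∑-lowerings-consecutive : ∀ i m s (g : List ℤ → ℚ) → Alternating g → i ℕ.≤ m →
                          ∑ (lowerings i (consecutive s m)) g ≡ g (lowerFirst i s m)
∑-lowerings-consecutive zero    m       s g alt i≤m = ℚ.+-identityʳ _
∑-lowerings-consecutive (suc j) (suc m) s g alt (s≤s j≤m) = begin
  ∑ (lowerings (suc j) (s ∷ rest)) g
    ≡⟨ ∑-lowerings-∷ (suc j) s rest g ⟩
  (∑[ D ∈ lowerings (suc j) rest ] g (s ∷ D)) + (∑[ D ∈ lowerings j rest ] g ((s ℤ.- 1ℤ) ∷ D))
    ≡⟨ cong₂ _+_ (s-unlowered m)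
                 (∑-lowerings-consecutive j m (s ℤ.+ 1ℤ) _ (λ D r → alt _ (skip r)) j≤m) ⟩
  0ℚ + g (lowerFirst (suc j) s (suc m))
    ≡⟨ ℚ.+-identityˡ _ ⟩
  g (lowerFirst (suc j) s (suc m)) ∎
  where
  rest = consecutive (s ℤ.+ 1ℤ) m
  s-unlowered : ∀ n → (∑[ D ∈ lowerings (suc j) (consecutive (s ℤ.+ 1ℤ) n) ] g (s ∷ D)) ≡ 0ℚ
  s-unlowered n with suc j ℕ.≤? n
  s-unlowered (suc n) | yes j<n = trans
    (∑-lowerings-consecutive (suc j) (suc n) (s ℤ.+ 1ℤ) (λ D → g (s ∷ D)) (λ D r → alt (s ∷ D) (skip r)) j<n)
    (alt _ (subst (λ t → AdjacentRepeat (s ∷ t ∷ lowerFirst j ((s ℤ.+ 1ℤ) ℤ.+ 1ℤ) n)) (sym (+1-1 s)) adjacent))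
  s-unlowered n       | no  j≮n = cong (λ L → ∑[ D ∈ L ] g (s ∷ D))
    (lowerings-empty (suc j) (consecutive (s ℤ.+ 1ℤ) n)
      (subst (ℕ._< suc j) (sym (length-consecutive (s ℤ.+ 1ℤ) n)) (ℕ.≰⇒> j≮n)))

range-suc : ∀ a k → range (suc a) k ≡ map suc (range a k)
range-suc a zero    = refl
range-suc a (suc k) = cong (suc a ∷_) (range-suc (suc a) k)

-- Deleting s + i from consecutive s (1 + m) leaves consecutive (s + 1) m with its
-- first i entries lowered.
expand-consecutive : ∀ m s (f : ℤ → List ℤ → ℚ) →
  expand (consecutive s (suc m)) f ≡
  (∑[ i ∈ range 0 (suc m) ] sgn i * f (s ℤ.+ + i) (lowerFirst i (s ℤ.+ 1ℤ) m))
expand-consecutive zero    s f = begin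
  f s [] - 0ℚ                  ≡⟨ ℚ.+-identityʳ _ ⟩
  f s []                       ≡⟨ sym (ℚ.*-identityˡ _) ⟩
  1ℚ * f s []                  ≡⟨ cong (λ t → 1ℚ * f t []) (sym (ℤ.+-identityʳ s)) ⟩
  1ℚ * f (s ℤ.+ + 0) []        ≡⟨ sym (ℚ.+-identityʳ _) ⟩
  1ℚ * f (s ℤ.+ + 0) [] + 0ℚ   ∎
expand-consecutive (suc m) s f = begin
  f s (consecutive s′ (suc m)) - expand (consecutive s′ (suc m)) (λ c R → f c (s ∷ R))
    ≡⟨ cong (_-_ (f s (consecutive s′ (suc m)))) (expand-consecutive m s′ (λ c R → f c (s ∷ R))) ⟩
  f s (consecutive s′ (suc m)) - (∑[ i ∈ range 0 (suc m) ] sgn i * f (s′ ℤ.+ + i) (s ∷ lowerFirst i (s′ ℤ.+ 1ℤ) m))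
    ≡⟨ cong₂ _+_ first (trans (sym (∑-neg (range 0 (suc m)) (λ i → sgn i * f (s′ ℤ.+ + i) (s ∷ lowerFirst i (s′ ℤ.+ 1ℤ) m))))
                                     (∑-cong (range 0 (suc m)) later)) ⟩
  F 0 + (∑[ i ∈ range 0 (suc m) ] F (suc i))
    ≡⟨ cong (_+_ (F 0)) (trans (sym (∑-map (range 0 (suc m)) suc F)) (cong (λ L → ∑ L F) (sym (range-suc 0 (suc m))))) ⟩
  ∑ (range 0 (suc (suc m))) F ∎
  where
  s′ = s ℤ.+ 1ℤ
  F : ℕ → ℚ
  F i = sgn i * f (s ℤ.+ + i) (lowerFirst i s′ (suc m))
  first : f s (consecutive s′ (suc m)) ≡ F 0
  first = trans (sym (ℚ.*-identityˡ _)) (cong (λ t → 1ℚ * f t (consecutive s′ (suc m))) (sym (ℤ.+-identityʳ s)))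
  later : ∀ i → - (sgn i * f (s′ ℤ.+ + i) (s ∷ lowerFirst i (s′ ℤ.+ 1ℤ) m)) ≡ F (suc i)
  later i = trans (ℚ.neg-distribˡ-* (sgn i) _)
                  (cong₂ (λ a b → sgn (suc i) * f a (b ∷ lowerFirst i (s′ ℤ.+ 1ℤ) m))
                         (ℤ.+-assoc s 1ℤ (+ i)) (sym (+1-1 s)))

𝟙-∧ : ∀ a b → 𝟙 (a ∧ b) ≡ 𝟙 a * 𝟙 b
𝟙-∧ true  b = sym (ℚ.*-identityˡ _)
𝟙-∧ false b = sym (ℚ.*-zeroˡ (𝟙 b))

≡ᵇ-refl : ∀ n → (n ≡ᵇ n) ≡ true
≡ᵇ-refl zero    = refl
≡ᵇ-refl (suc n) = ≡ᵇ-refl n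

≢⇒≡ᵇ-false : ∀ m n → m ≢ n → (m ≡ᵇ n) ≡ false
≢⇒≡ᵇ-false m n m≢n with m ≡ᵇ n in eq
... | false = refl
... | true  = ⊥-elim (m≢n (ℕ.≡ᵇ⇒≡ m n (subst T (sym eq) tt)))

𝟙-≡ᵇ-subst : ∀ m n (u : ℕ → ℚ) → 𝟙 (m ≡ᵇ n) * u m ≡ 𝟙 (m ≡ᵇ n) * u n
𝟙-≡ᵇ-subst m n u with m ℕ.≟ n
... | yes refl = refl
... | no  m≢n rewrite ≢⇒≡ᵇ-false m n m≢n = trans (ℚ.*-zeroˡ (u m)) (sym (ℚ.*-zeroˡ (u n)))

·N-∷ : ∀ (x y : NSym) a γ → (x ·N y) (a ∷ γ) ≡ x [] * y (a ∷ γ) + ((λ p → x (a ∷ p)) ·N y) γ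
·N-∷ x y a γ = cong (_+_ (x [] * y (a ∷ γ)))
  (trans (∑-map (splits γ) _ _) (∑-cong (splits γ) (λ { (p , q) → refl })))

·N-congʳ : ∀ (x : NSym) {y y′ : NSym} → (∀ q → y q ≡ y′ q) → ∀ γ → (x ·N y) γ ≡ (x ·N y′) γ
·N-congʳ x y≗y′ γ = ∑-cong (splits γ) (λ { (p , q) → cong (x p *_) (y≗y′ q) })

·N-congʳ-≈N : ∀ (x : NSym) {y y′ : NSym} → y ≈N y′ → ∀ γ → IsComposition γ → (x ·N y) γ ≡ (x ·N y′) γ
·N-congʳ-≈N x y≈y′ []      _          = cong (λ t → x [] * t + 0ℚ) (y≈y′ [] [])
·N-congʳ-≈N x {y} {y′} y≈y′ (a ∷ γ) (a>0 ∷ γ⁺) = begin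
  (x ·N y) (a ∷ γ)                              ≡⟨ ·N-∷ x y a γ ⟩
  x [] * y (a ∷ γ) + ((λ p → x (a ∷ p)) ·N y) γ
    ≡⟨ cong₂ (λ u v → x [] * u + v) (y≈y′ (a ∷ γ) (a>0 ∷ γ⁺)) (·N-congʳ-≈N (λ p → x (a ∷ p)) y≈y′ γ γ⁺) ⟩
  x [] * y′ (a ∷ γ) + ((λ p → x (a ∷ p)) ·N y′) γ ≡⟨ sym (·N-∷ x y′ a γ) ⟩
  (x ·N y′) (a ∷ γ)                             ∎

·N-zeroˡ : ∀ (x y : NSym) → (∀ p → x p ≡ 0ℚ) → ∀ γ → (x ·N y) γ ≡ 0ℚ
·N-zeroˡ x y x≗0 γ = ∑-zero (splits γ) (λ { (p , q) → trans (cong (_* y q) (x≗0 p)) (ℚ.*-zeroˡ (y q)) })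

·N-zeroʳ : ∀ (x : NSym) γ → (x ·N zeroN) γ ≡ 0ℚ
·N-zeroʳ x γ = ∑-zero (splits γ) (λ { (p , q) → ℚ.*-zeroʳ (x p) })

·N-constˡ : ∀ (x y : NSym) → (∀ a p → x (a ∷ p) ≡ 0ℚ) → ∀ γ → (x ·N y) γ ≡ x [] * y γ
·N-constˡ x y x-const []      = ℚ.+-identityʳ _
·N-constˡ x y x-const (a ∷ γ) = trans (·N-∷ x y a γ)
  (trans (cong (_+_ (x [] * y (a ∷ γ))) (·N-zeroˡ (λ p → x (a ∷ p)) y (x-const a) γ)) (ℚ.+-identityʳ _))

·N-identityˡ : ∀ (y : NSym) γ → (oneN ·N y) γ ≡ y γ
·N-identityˡ y γ = trans (·N-constˡ oneN y (λ a p → refl) γ) (ℚ.*-identityˡ (y γ))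

·N-∑ʳ : ∀ (x : NSym) (xs : List I) (y : I → NSym) γ →
        (x ·N (λ q → ∑[ i ∈ xs ] y i q)) γ ≡ (∑[ i ∈ xs ] (x ·N y i) γ)
·N-∑ʳ x xs y γ = trans (∑-cong (splits γ) (λ { (p , q) → sym (∑-*ˡ xs (x p) (λ i → y i q)) }))
                       (∑-comm (splits γ) xs (λ { (p , q) i → x p * y i q }))

·N-detʳ : ∀ (x : NSym) β C (φ : List ℕ → List ℤ → ℚ) γ →
          (x ·N (λ δ → det β C (φ δ))) γ ≡ det β C (λ w → (x ·N (λ δ → φ δ w)) γ)
·N-detʳ x β C φ γ = trans (∑-cong (splits γ) (λ { (p , q) → sym (det-*ˡ β C (x p) (φ q)) }))
                          (sym (det-∑ β C (splits γ) (λ { (p , q) w → x p * φ q w })))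

-- prepend k y is the coefficient function of H_k y, for k > 0.
prepend : ℕ → NSym → NSym
prepend k y []      = 0ℚ
prepend k y (a ∷ γ) = 𝟙 (a ≡ᵇ k) * y γ

prepend-cong : ∀ k {y y′ : NSym} → (∀ γ → y γ ≡ y′ γ) → ∀ γ → prepend k y γ ≡ prepend k y′ γ
prepend-cong k y≗y′ []      = refl
prepend-cong k y≗y′ (a ∷ γ) = cong (𝟙 (a ≡ᵇ k) *_) (y≗y′ γ)

prepend-zero : ∀ k {y : NSym} → (∀ γ → y γ ≡ 0ℚ) → ∀ γ → prepend k y γ ≡ 0ℚ
prepend-zero k y≗0 []      = refl
prepend-zero k y≗0 (a ∷ γ) = trans (cong (𝟙 (a ≡ᵇ k) *_) (y≗0 γ)) (ℚ.*-zeroʳ (𝟙 (a ≡ᵇ k)))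

prepend-+ : ∀ k (y y′ : NSym) γ → prepend k (λ δ → y δ + y′ δ) γ ≡ prepend k y γ + prepend k y′ γ
prepend-+ k y y′ []      = sym (ℚ.+-identityˡ 0ℚ)
prepend-+ k y y′ (a ∷ γ) = ℚ.*-distribˡ-+ (𝟙 (a ≡ᵇ k)) (y γ) (y′ γ)

H-suc-·N : ∀ k (y : NSym) γ → (H (+ suc k) ·N y) γ ≡ prepend (suc k) y γ
H-suc-·N k y []      = trans (ℚ.+-identityʳ _) (ℚ.*-zeroˡ (y []))
H-suc-·N k y (a ∷ γ) = begin
  (H (+ suc k) ·N y) (a ∷ γ)   ≡⟨ ·N-∷ (H (+ suc k)) y a γ ⟩
  0ℚ * y (a ∷ γ) + (x ·N y) γ  ≡⟨ cong₂ _+_ (ℚ.*-zeroˡ (y (a ∷ γ))) (·N-constˡ x y x-const γ) ⟩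
  0ℚ + x [] * y γ              ≡⟨ ℚ.+-identityˡ _ ⟩
  x [] * y γ                   ≡⟨ cong (λ b → 𝟙 b * y γ) (∧-identityʳ (a ≡ᵇ suc k)) ⟩
  𝟙 (a ≡ᵇ suc k) * y γ         ∎
  where
  x : NSym
  x p = H (+ suc k) (a ∷ p)
  x-const : ∀ b p → x (b ∷ p) ≡ 0ℚ
  x-const b p = cong 𝟙 (∧-zeroʳ (a ≡ᵇ suc k))

H-neg-·N : ∀ n (y : NSym) γ → (H -[1+ n ] ·N y) γ ≡ 0ℚ
H-neg-·N n y γ = ·N-zeroˡ zeroN y (λ p → refl) γ

Hword : List ℤ → NSym
Hword []      = oneN
Hword (x ∷ w) = H x ·N Hword w

compositions-IsComposition : ∀ n → All IsComposition (compositions n)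
compositions-IsComposition zero          = [] ∷ []
compositions-IsComposition (suc zero)    = (s≤s z≤n ∷ []) ∷ []
compositions-IsComposition (suc (suc n)) =
  All.++⁺ (All.map⁺ (All.map (s≤s z≤n ∷_) (compositions-IsComposition (suc n))))
          (All.map⁺ (All.map incHead-IsComposition (compositions-IsComposition (suc n))))
  where
  incHead-IsComposition : ∀ {α} → IsComposition α → IsComposition (incHead α)
  incHead-IsComposition []      = []
  incHead-IsComposition (_ ∷ α) = s≤s z≤n ∷ α

compositions-nonempty : ∀ n → All (_≢ []) (compositions (suc n))
compositions-nonempty zero    = (λ ()) ∷ []
compositions-nonempty (suc n) =
  All.++⁺ (All.map⁺ (All.map (λ _ ()) (compositions-nonempty n)))
          (All.map⁺ (All.map incHead-nonempty (compositions-nonempty n)))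
  where
  incHead-nonempty : ∀ {α} → α ≢ [] → incHead α ≢ []
  incHead-nonempty {[]}    α≢[] = ⊥-elim (α≢[] refl)
  incHead-nonempty {_ ∷ _} _    = λ ()

∑-compositions-prepend : ∀ k r (g : NSym) →
  ∑ (compositions (suc k ℕ.+ r)) (prepend (suc k) g) ≡ ∑ (compositions r) g
∑-compositions-prepend zero    zero    g = cong (_+ 0ℚ) (ℚ.*-identityˡ (g []))
∑-compositions-prepend zero    (suc r) g = begin
  ∑ (map (1 ∷_) C ++ map incHead C) (prepend 1 g)
    ≡⟨ ∑-map-++ C C (1 ∷_) incHead (prepend 1 g) ⟩
  (∑[ α ∈ C ] 1ℚ * g α) + (∑[ α ∈ C ] prepend 1 g (incHead α))
    ≡⟨ cong₂ _+_ (∑-cong C (λ α → ℚ.*-identityˡ (g α)))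
                 (∑-cong-All C (compositions-IsComposition (suc r)) head-not-1) ⟩
  ∑ C g + (∑[ α ∈ C ] 0ℚ)
    ≡⟨ cong (_+_ (∑ C g)) (∑-zero C (λ _ → refl)) ⟩
  ∑ C g + 0ℚ
    ≡⟨ ℚ.+-identityʳ _ ⟩
  ∑ C g ∎
  where
  C = compositions (suc r)
  head-not-1 : ∀ α → IsComposition α → prepend 1 g (incHead α) ≡ 0ℚ
  head-not-1 []          _           = refl
  head-not-1 (suc a ∷ α) (s≤s _ ∷ _) = ℚ.*-zeroˡ (g α)
∑-compositions-prepend (suc k) r g = begin
  ∑ (map (1 ∷_) C ++ map incHead C) (prepend (2 ℕ.+ k) g)
    ≡⟨ ∑-map-++ C C (1 ∷_) incHead (prepend (2 ℕ.+ k) g) ⟩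
  (∑[ α ∈ C ] 0ℚ * g α) + (∑[ α ∈ C ] prepend (2 ℕ.+ k) g (incHead α))
    ≡⟨ cong₂ _+_ (∑-zero C (λ α → ℚ.*-zeroˡ (g α))) (∑-cong C prepend-incHead) ⟩
  0ℚ + ∑ C (prepend (suc k) g)
    ≡⟨ ℚ.+-identityˡ _ ⟩
  ∑ C (prepend (suc k) g)
    ≡⟨ ∑-compositions-prepend k r g ⟩
  ∑ (compositions r) g ∎
  where
  C = compositions (suc k ℕ.+ r)
  prepend-incHead : ∀ α → prepend (2 ℕ.+ k) g (incHead α) ≡ prepend (suc k) g α
  prepend-incHead []      = refl
  prepend-incHead (a ∷ α) = refl

⋆-∷ : ∀ (F G : Series) a e →
  (F ⋆ G) (a ∷ e) ≡ (∑[ k ∈ range 0 (suc a) ] ((λ p → F (k ∷ p)) ⋆ (λ q → G ((a ℕ.∸ k) ∷ q))) e)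
⋆-∷ F G a e = begin
  ∑ (concatMap (λ k → map (split k) (decomp e)) (range 0 (suc a))) (λ { (p , q) → F p * G q })
    ≡⟨ ∑-concatMap (range 0 (suc a)) (λ k → map (split k) (decomp e)) _ ⟩
  (∑[ k ∈ range 0 (suc a) ] ∑ (map (split k) (decomp e)) (λ { (p , q) → F p * G q }))
    ≡⟨ ∑-cong (range 0 (suc a)) (λ k → trans (∑-map (decomp e) (split k) _)
                                             (∑-cong (decomp e) (λ { (p , q) → refl }))) ⟩
  (∑[ k ∈ range 0 (suc a) ] ((λ p → F (k ∷ p)) ⋆ (λ q → G ((a ℕ.∸ k) ∷ q))) e) ∎
  where
  split : ℕ → List ℕ × List ℕ → List ℕ × List ℕ
  split k (p , q) = (k ∷ p , (a ℕ.∸ k) ∷ q)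

⋆-cong : ∀ {F F′ G G′ : Series} → (∀ p → F p ≡ F′ p) → (∀ q → G q ≡ G′ q) →
         ∀ e → (F ⋆ G) e ≡ (F′ ⋆ G′) e
⋆-cong F≗F′ G≗G′ e = ∑-cong (decomp e) (λ { (p , q) → cong₂ _*_ (F≗F′ p) (G≗G′ q) })

⋆-*ʳ : ∀ (F G : Series) k e → (F ⋆ (λ q → k * G q)) e ≡ k * (F ⋆ G) e
⋆-*ʳ F G k e = trans (∑-cong (decomp e) (λ { (p , q) → *-left-commute (F p) k (G q) }))
                     (∑-*ˡ (decomp e) k (λ { (p , q) → F p * G q }))
  where
  open ℚ-Solver
  *-left-commute : ∀ a k b → a * (k * b) ≡ k * (a * b)
  *-left-commute = solve 3 (λ a k b → a :* (k :* b) := k :* (a :* b)) refl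

⋆-zeroˡ : ∀ (F G : Series) → (∀ p → F p ≡ 0ℚ) → ∀ e → (F ⋆ G) e ≡ 0ℚ
⋆-zeroˡ F G F≗0 e = ∑-zero (decomp e) (λ { (p , q) → trans (cong (_* G q) (F≗0 p)) (ℚ.*-zeroˡ (G q)) })

⋆-zeroʳ : ∀ (F G : Series) → (∀ q → G q ≡ 0ℚ) → ∀ e → (F ⋆ G) e ≡ 0ℚ
⋆-zeroʳ F G G≗0 e = ∑-zero (decomp e) (λ { (p , q) → trans (cong (F p *_) (G≗0 q)) (ℚ.*-zeroʳ (F p)) })

F1-∷-≥2 : ∀ i j p → F1 i (2 ℕ.+ j ∷ p) ≡ 0ℚ
F1-∷-≥2 zero    j p = refl
F1-∷-≥2 (suc i) j p = refl

-- F_{1^i} is squarefree, so the first exponent a + 1 of a monomial of F_{1^i} G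
-- comes from G entirely or from G and x₁ once.
F1⋆-∷ : ∀ i (G : Series) a e →
  (F1 i ⋆ G) (suc a ∷ e) ≡ (F1 i ⋆ (λ q → G (suc a ∷ q))) e + ((λ p → F1 i (1 ∷ p)) ⋆ (λ q → G (a ∷ q))) e
F1⋆-∷ i G a e = begin
  (F1 i ⋆ G) (suc a ∷ e)
    ≡⟨ ⋆-∷ (F1 i) G (suc a) e ⟩
  term 0 + (term 1 + ∑ (range 2 a) term)
    ≡⟨ cong (λ t → term 0 + (term 1 + t)) exponent≥2 ⟩
  term 0 + (term 1 + 0ℚ)
    ≡⟨ cong (_+_ (term 0)) (ℚ.+-identityʳ (term 1)) ⟩
  term 0 + term 1 ∎
  where
  term : ℕ → ℚ
  term k = ((λ p → F1 i (k ∷ p)) ⋆ (λ q → G ((suc a ℕ.∸ k) ∷ q))) e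
  exponent≥2 : ∑ (range 2 a) term ≡ 0ℚ
  exponent≥2 = begin
    ∑ (range 2 a) term
      ≡⟨ cong (λ L → ∑ L term) (trans (range-suc 1 a) (cong (map suc) (range-suc 0 a))) ⟩
    ∑ (map suc (map suc (range 0 a))) term
      ≡⟨ trans (∑-map (map suc (range 0 a)) suc term) (∑-map (range 0 a) suc (λ k → term (suc k))) ⟩
    (∑[ j ∈ range 0 a ] term (2 ℕ.+ j))
      ≡⟨ ∑-zero (range 0 a) (λ j → ⋆-zeroˡ _ _ (F1-∷-≥2 i j) e) ⟩
    0ℚ ∎

M-∷-suc : ∀ b β K q → M (b ∷ β) (suc K ∷ q) ≡ 𝟙 (suc K ≡ᵇ b) * M β q
M-∷-suc b β K q = 𝟙-∧ (suc K ≡ᵇ b) (eqList (filterᵇ (λ k → not (k ≡ᵇ 0)) q) β)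

⋆-M-∷-suc : ∀ (F : Series) b β K e → (F ⋆ (λ q → M (b ∷ β) (suc K ∷ q))) e ≡ 𝟙 (suc K ≡ᵇ b) * (F ⋆ M β) e
⋆-M-∷-suc F b β K e = trans (⋆-cong {F} (λ _ → refl) (M-∷-suc b β K) e) (⋆-*ʳ F (M β) (𝟙 (suc K ≡ᵇ b)) e)

F1perp-cong : ∀ i {x y : NSym} → x ≈N y → ∀ β → F1perp i x β ≡ F1perp i y β
F1perp-cong i x≈y β = ∑-cong-All (compositions (i ℕ.+ sum β)) (compositions-IsComposition (i ℕ.+ sum β))
  (λ α α⁺ → cong (_* (F1 i ⋆ M β) α) (x≈y α α⁺))

F1perp-det : ∀ i β C (φ : List ℕ → List ℤ → ℚ) γ →
             F1perp i (λ δ → det β C (φ δ)) γ ≡ det β C (λ w → F1perp i (λ δ → φ δ w) γ)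
F1perp-det i β C φ γ = begin
  (∑[ α ∈ L ] det β C (φ α) * c α)
    ≡⟨ ∑-cong L (λ α → trans (ℚ.*-comm _ (c α)) (sym (det-*ˡ β C (c α) (φ α)))) ⟩
  (∑[ α ∈ L ] det β C (λ w → c α * φ α w))
    ≡⟨ sym (det-∑ β C L (λ α w → c α * φ α w)) ⟩
  det β C (λ w → ∑[ α ∈ L ] c α * φ α w)
    ≡⟨ det-cong β C (λ w → ∑-cong L (λ α → ℚ.*-comm (c α) (φ α w))) ⟩
  det β C (λ w → F1perp i (λ δ → φ δ w) γ) ∎
  where
  L = compositions (i ℕ.+ sum γ)
  c : List ℕ → ℚ
  c α = (F1 i ⋆ M γ) α

-- The leading letter of F_{1^j}^⊥ Y, read off from F_{1^j}^⊥ (H_{d+K+1} Y); the two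
-- halves of the Leibniz rule below are the cases d = 0 and d = 1.
∑-prepend-F1perp : ∀ (Y : NSym) d K j β →
  ∑ (compositions (d ℕ.+ (j ℕ.+ sum β)))
    (prepend (d ℕ.+ suc K) (λ α → Y α * (F1 j ⋆ (λ q → M β (suc K ∷ q))) α))
  ≡ prepend (suc K) (F1perp j Y) β
∑-prepend-F1perp Y d K j [] =
  ∑-zero (compositions (d ℕ.+ (j ℕ.+ 0)))
    (prepend-zero (d ℕ.+ suc K) (λ α → trans (cong (Y α *_) (⋆-zeroʳ (F1 j) _ (λ q → refl) α)) (ℚ.*-zeroʳ (Y α))))
∑-prepend-F1perp Y d K j (b ∷ β) with b ℕ.≟ suc K
... | no b≢1+K = trans
  (∑-zero (compositions (d ℕ.+ (j ℕ.+ (b ℕ.+ sum β)))) (prepend-zero (d ℕ.+ suc K) term≡0))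
  (sym (trans (cong (λ t → 𝟙 t * F1perp j Y β) (≢⇒≡ᵇ-false b (suc K) b≢1+K)) (ℚ.*-zeroˡ (F1perp j Y β))))
  where
  term≡0 : ∀ α → Y α * (F1 j ⋆ (λ q → M (b ∷ β) (suc K ∷ q))) α ≡ 0ℚ
  term≡0 α = begin
    Y α * (F1 j ⋆ (λ q → M (b ∷ β) (suc K ∷ q))) α ≡⟨ cong (Y α *_) (⋆-M-∷-suc (F1 j) b β K α) ⟩
    Y α * (𝟙 (suc K ≡ᵇ b) * (F1 j ⋆ M β) α)
      ≡⟨ cong (λ t → Y α * (𝟙 t * (F1 j ⋆ M β) α)) (≢⇒≡ᵇ-false (suc K) b (b≢1+K ∘ sym)) ⟩
    Y α * (0ℚ * (F1 j ⋆ M β) α)                    ≡⟨ cong (Y α *_) (ℚ.*-zeroˡ ((F1 j ⋆ M β) α)) ⟩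
    Y α * 0ℚ                                        ≡⟨ ℚ.*-zeroʳ (Y α) ⟩
    0ℚ                                              ∎
... | yes refl = begin
  ∑ (compositions (d ℕ.+ (j ℕ.+ (suc K ℕ.+ s)))) (prepend (d ℕ.+ suc K) g)
    ≡⟨ ∑-cong (compositions (d ℕ.+ (j ℕ.+ (suc K ℕ.+ s)))) (prepend-cong (d ℕ.+ suc K) g≗term) ⟩
  ∑ (compositions (d ℕ.+ (j ℕ.+ (suc K ℕ.+ s)))) (prepend (d ℕ.+ suc K) term)
    ≡⟨ cong₂ (λ n k → ∑ (compositions n) (prepend k term)) size (ℕ.+-suc d K) ⟩
  ∑ (compositions (suc (d ℕ.+ K) ℕ.+ (j ℕ.+ s))) (prepend (suc (d ℕ.+ K)) term)
    ≡⟨ ∑-compositions-prepend (d ℕ.+ K) (j ℕ.+ s) term ⟩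
  F1perp j Y β
    ≡⟨ sym (trans (cong (λ t → 𝟙 t * F1perp j Y β) (≡ᵇ-refl K)) (ℚ.*-identityˡ _)) ⟩
  prepend (suc K) (F1perp j Y) (suc K ∷ β) ∎
  where
  open ℕ-Solver
  s = sum β
  g term : NSym
  g α = Y α * (F1 j ⋆ (λ q → M (suc K ∷ β) (suc K ∷ q))) α
  term α = Y α * (F1 j ⋆ M β) α
  g≗term : ∀ α → g α ≡ term α
  g≗term α = cong (Y α *_) (trans (⋆-M-∷-suc (F1 j) (suc K) β K α)
                                  (trans (cong (λ t → 𝟙 t * (F1 j ⋆ M β) α) (≡ᵇ-refl K)) (ℚ.*-identityˡ _)))
  size : d ℕ.+ (j ℕ.+ (suc K ℕ.+ s)) ≡ suc (d ℕ.+ K) ℕ.+ (j ℕ.+ s)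
  size = solve 4 (λ d j K s → d :+ (j :+ (con 1 :+ K :+ s)) := con 1 :+ (d :+ K) :+ (j :+ s)) refl d j K s

F1perp⁻ : ℕ → NSym → NSym
F1perp⁻ zero    Y = zeroN
F1perp⁻ (suc i) Y = F1perp i Y

-- The terms of F_{1^i}^⊥ (H_{k+1} Y) in which x₁ of F_{1^i} lowers the letter k + 1.
∑-prepend-F1perp⁻ : ∀ i k (Y : NSym) β →
  ∑ (compositions (i ℕ.+ sum β))
    (prepend (suc k) (λ α → Y α * ((λ p → F1 i (1 ∷ p)) ⋆ (λ q → M β (k ∷ q))) α))
  ≡ (H (+ k) ·N F1perp⁻ i Y) β
∑-prepend-F1perp⁻ zero     k        Y β = trans
  (∑-zero (compositions (sum β))
    (prepend-zero (suc k) (λ α → trans (cong (Y α *_) (⋆-zeroˡ _ (λ q → M β (k ∷ q)) (λ p → refl) α))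
                                       (ℚ.*-zeroʳ (Y α)))))
  (sym (·N-zeroʳ (H (+ k)) β))
∑-prepend-F1perp⁻ (suc i) zero     Y β = begin
  ∑ (compositions (suc (i ℕ.+ sum β))) (prepend 1 (λ α → Y α * (F1 i ⋆ M β) α))
    ≡⟨ ∑-compositions-prepend 0 (i ℕ.+ sum β) _ ⟩
  F1perp i Y β
    ≡⟨ sym (·N-identityˡ (F1perp i Y) β) ⟩
  (oneN ·N F1perp i Y) β ∎
∑-prepend-F1perp⁻ (suc i) (suc k) Y β = begin
  ∑ (compositions (1 ℕ.+ (i ℕ.+ sum β)))
    (prepend (1 ℕ.+ suc k) (λ α → Y α * (F1 i ⋆ (λ q → M β (suc k ∷ q))) α))
    ≡⟨ ∑-prepend-F1perp Y 1 k i β ⟩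
  prepend (suc k) (F1perp i Y) β
    ≡⟨ sym (H-suc-·N k (F1perp i Y) β) ⟩
  (H (+ suc k) ·N F1perp i Y) β ∎

prepend-*ʳ : ∀ k (y : NSym) (u : List ℕ → ℚ) α →
             prepend k y α * u α ≡ prepend k (λ α′ → y α′ * u (k ∷ α′)) α
prepend-*ʳ k y u []       = ℚ.*-zeroˡ (u [])
prepend-*ʳ k y u (a ∷ α′) = trans (ℚ.*-assoc (𝟙 (a ≡ᵇ k)) (y α′) (u (a ∷ α′)))
                                  (𝟙-≡ᵇ-subst a k (λ t → y α′ * u (t ∷ α′)))

F1perp-Leibniz : ∀ i x (Y : NSym) β →
  F1perp i (H x ·N Y) β ≡ (H x ·N F1perp i Y) β + (H (x ℤ.- 1ℤ) ·N F1perp⁻ i Y) β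
F1perp-Leibniz i -[1+ n ] Y β = begin
  F1perp i (H -[1+ n ] ·N Y) β
    ≡⟨ ∑-zero (compositions (i ℕ.+ sum β)) (λ α → trans (cong (_* (F1 i ⋆ M β) α) (H-neg-·N n Y α))
                                                       (ℚ.*-zeroˡ ((F1 i ⋆ M β) α))) ⟩
  0ℚ
    ≡⟨ sym (cong₂ _+_ (H-neg-·N n (F1perp i Y) β) (·N-zeroˡ zeroN (F1perp⁻ i Y) (λ p → refl) β)) ⟩
  (H -[1+ n ] ·N F1perp i Y) β + (H (-[1+ n ] ℤ.- 1ℤ) ·N F1perp⁻ i Y) β ∎
F1perp-Leibniz i (+ zero) Y β = begin
  F1perp i (oneN ·N Y) β
    ≡⟨ ∑-cong (compositions (i ℕ.+ sum β)) (λ α → cong (_* (F1 i ⋆ M β) α) (·N-identityˡ Y α)) ⟩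
  F1perp i Y β
    ≡⟨ sym (ℚ.+-identityʳ _) ⟩
  F1perp i Y β + 0ℚ
    ≡⟨ sym (cong₂ _+_ (·N-identityˡ (F1perp i Y) β) (·N-zeroˡ zeroN (F1perp⁻ i Y) (λ p → refl) β)) ⟩
  (oneN ·N F1perp i Y) β + (H (+ zero ℤ.- 1ℤ) ·N F1perp⁻ i Y) β ∎
F1perp-Leibniz i (+ suc k) Y β = begin
  (∑[ α ∈ C ] (H (+ suc k) ·N Y) α * c α)
    ≡⟨ ∑-cong C (λ α → trans (cong (_* c α) (H-suc-·N k Y α)) (prepend-*ʳ (suc k) Y c α)) ⟩
  ∑ C (prepend (suc k) (λ α → Y α * c (suc k ∷ α)))
    ≡⟨ ∑-cong C (λ α → trans (prepend-cong (suc k) split α) (prepend-+ (suc k) g₀ g₁ α)) ⟩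
  (∑[ α ∈ C ] (prepend (suc k) g₀ α + prepend (suc k) g₁ α))
    ≡⟨ ∑-+ C (prepend (suc k) g₀) (prepend (suc k) g₁) ⟩
  ∑ C (prepend (suc k) g₀) + ∑ C (prepend (suc k) g₁)
    ≡⟨ cong₂ _+_ (trans (∑-prepend-F1perp Y 0 k i β) (sym (H-suc-·N k (F1perp i Y) β)))
                 (∑-prepend-F1perp⁻ i k Y β) ⟩
  (H (+ suc k) ·N F1perp i Y) β + (H (+ k) ·N F1perp⁻ i Y) β ∎
  where
  C = compositions (i ℕ.+ sum β)
  c : List ℕ → ℚ
  c α = (F1 i ⋆ M β) α
  g₀ g₁ : NSym
  g₀ α = Y α * (F1 i ⋆ (λ q → M β (suc k ∷ q))) α
  g₁ α = Y α * ((λ p → F1 i (1 ∷ p)) ⋆ (λ q → M β (k ∷ q))) α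
  split : ∀ α → Y α * c (suc k ∷ α) ≡ g₀ α + g₁ α
  split α = trans (cong (Y α *_) (F1⋆-∷ i (M β) k α)) (ℚ.*-distribˡ-+ (Y α) _ _)

∑-compositions-suc-oneN : ∀ n (u : List ℕ → ℚ) → (∑[ α ∈ compositions (suc n) ] oneN α * u α) ≡ 0ℚ
∑-compositions-suc-oneN n u = trans (∑-cong-All (compositions (suc n)) (compositions-nonempty n) oneN-∷)
                                    (∑-zero (compositions (suc n)) (λ _ → refl))
  where
  oneN-∷ : ∀ α → α ≢ [] → oneN α * u α ≡ 0ℚ
  oneN-∷ []      α≢[] = ⊥-elim (α≢[] refl)
  oneN-∷ (_ ∷ α) _    = ℚ.*-zeroˡ (u (_ ∷ α))

F1perp-oneN : ∀ i β → IsComposition β → F1perp i oneN β ≡ (∑[ w ∈ lowerings i [] ] Hword w β)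
F1perp-oneN zero    []          _        = refl
F1perp-oneN zero    (zero ∷ β)  (() ∷ _)
F1perp-oneN zero    (suc b ∷ β) _        =
  trans (∑-compositions-suc-oneN (b ℕ.+ sum β) _) (sym (ℚ.+-identityˡ 0ℚ))
F1perp-oneN (suc i) β           _        = ∑-compositions-suc-oneN (i ℕ.+ sum β) _

F1perp-Hword : ∀ w i β → IsComposition β → F1perp i (Hword w) β ≡ (∑[ w′ ∈ lowerings i w ] Hword w′ β)
F1perp-Hword []      i β β⁺ = F1perp-oneN i β β⁺
F1perp-Hword (x ∷ w) i β β⁺ = begin
  F1perp i (H x ·N Hword w) β
    ≡⟨ F1perp-Leibniz i x (Hword w) β ⟩
  (H x ·N F1perp i (Hword w)) β + (H (x ℤ.- 1ℤ) ·N F1perp⁻ i (Hword w)) β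
    ≡⟨ cong₂ _+_ (H-·N-F1perp x i) (H-·N-F1perp⁻ i) ⟩
  (∑[ D ∈ lowerings i w ] (H x ·N Hword D) β) + (∑[ D ∈ lowerings⁻ i w ] (H (x ℤ.- 1ℤ) ·N Hword D) β)
    ≡⟨ sym (∑-lowerings-∷ i x w (λ w′ → Hword w′ β)) ⟩
  (∑[ w′ ∈ lowerings i (x ∷ w) ] Hword w′ β) ∎
  where
  H-·N-F1perp : ∀ y j → (H y ·N F1perp j (Hword w)) β ≡ (∑[ D ∈ lowerings j w ] (H y ·N Hword D) β)
  H-·N-F1perp y j = trans (·N-congʳ-≈N (H y) (λ q q⁺ → F1perp-Hword w j q q⁺) β β⁺)
                          (·N-∑ʳ (H y) (lowerings j w) Hword β)
  H-·N-F1perp⁻ : ∀ j → (H (x ℤ.- 1ℤ) ·N F1perp⁻ j (Hword w)) β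
                       ≡ (∑[ D ∈ lowerings⁻ j w ] (H (x ℤ.- 1ℤ) ·N Hword D) β)
  H-·N-F1perp⁻ zero    = ·N-zeroʳ (H (x ℤ.- 1ℤ)) β
  H-·N-F1perp⁻ (suc j) = H-·N-F1perp (x ℤ.- 1ℤ) j

prepend-vanish : ∀ k (y : NSym) γ → sum γ ℕ.< suc k → prepend (suc k) y γ ≡ 0ℚ
prepend-vanish k y []      _ = refl
prepend-vanish k y (b ∷ γ) Σγ<1+k with b ℕ.≟ suc k
... | yes refl = ⊥-elim (ℕ.<-irrefl refl (ℕ.<-≤-trans Σγ<1+k (ℕ.m≤m+n (suc k) (sum γ))))
... | no  b≢1+k = trans (cong (λ t → 𝟙 t * y γ) (≢⇒≡ᵇ-false b (suc k) b≢1+k)) (ℚ.*-zeroˡ (y γ))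

H-·N-vanish : ∀ z (Y : NSym) γ → + sum γ ℤ.< z → (H z ·N Y) γ ≡ 0ℚ
H-·N-vanish (+ suc k) Y γ (ℤ.+<+ Σγ<1+k) = trans (H-suc-·N k Y γ) (prepend-vanish k Y γ Σγ<1+k)
H-·N-vanish (+ zero)  Y γ (ℤ.+<+ ())

i≤+∣i∣ : ∀ i → i ℤ.≤ + ∣ i ∣
i≤+∣i∣ (+ n)    = ℤ.≤-refl
i≤+∣i∣ -[1+ n ] = ℤ.-≤+

-- The sum defining 𝔹_a stops at i = ∣ |γ| - a ∣, past which H_{a+i} is too large.
H-+-·N-vanish : ∀ a i (Y : NSym) γ → ∣ + sum γ ℤ.- a ∣ ℕ.< i → (H (a ℤ.+ + i) ·N Y) γ ≡ 0ℚ
H-+-·N-vanish a i Y γ lt = H-·N-vanish (a ℤ.+ + i) Y γ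
  (ℤ.≤-<-trans (ℤ.≤-reflexive s≡a+[s-a]) (ℤ.+-monoʳ-< a (ℤ.≤-<-trans (i≤+∣i∣ (+ s ℤ.- a)) (ℤ.+<+ lt))))
  where
  open ℤ-Solver
  s = sum γ
  s≡a+[s-a] : + s ≡ a ℤ.+ (+ s ℤ.- a)
  s≡a+[s-a] = solve 2 (λ s a → s := a :+ (s :- a)) refl (+ s) a

range-++ : ∀ a n k → range a (n ℕ.+ k) ≡ range a n ++ range (a ℕ.+ n) k
range-++ a zero    k = cong (λ t → range t k) (sym (ℕ.+-identityʳ a))
range-++ a (suc n) k = cong (a ∷_) (trans (range-++ (suc a) n k)
                                          (cong (λ t → range (suc a) n ++ range t k) (sym (ℕ.+-suc a n))))

range-≥ : ∀ a k → All (a ℕ.≤_) (range a k)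
range-≥ a zero    = []
range-≥ a (suc k) = ℕ.≤-refl ∷ All.map (ℕ.≤-trans (ℕ.n≤1+n a)) (range-≥ (suc a) k)

range-< : ∀ a k → All (ℕ._< a ℕ.+ k) (range a k)
range-< a zero    = []
range-< a (suc k) = subst (a ℕ.<_) (sym (ℕ.+-suc a k)) (s≤s (ℕ.m≤m+n a k))
                  ∷ All.map (λ {i} → subst (i ℕ.<_) (sym (ℕ.+-suc a k))) (range-< (suc a) k)

∑-range-truncate : ∀ n k (f : ℕ → ℚ) → (∀ i → n ℕ.≤ i → f i ≡ 0ℚ) → ∑ (range 0 (n ℕ.+ k)) f ≡ ∑ (range 0 n) f
∑-range-truncate n k f f≥n≡0 = begin
  ∑ (range 0 (n ℕ.+ k)) f             ≡⟨ cong (λ L → ∑ L f) (range-++ 0 n k) ⟩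
  ∑ (range 0 n ++ range n k) f        ≡⟨ ∑-++ (range 0 n) (range n k) f ⟩
  ∑ (range 0 n) f + ∑ (range n k) f   ≡⟨ cong (_+_ (∑ (range 0 n) f)) (∑-zero-≥ (range n k) (range-≥ n k)) ⟩
  ∑ (range 0 n) f + 0ℚ                ≡⟨ ℚ.+-identityʳ _ ⟩
  ∑ (range 0 n) f                     ∎
  where
  ∑-zero-≥ : ∀ is → All (n ℕ.≤_) is → ∑ is f ≡ 0ℚ
  ∑-zero-≥ is n≤is = trans (∑-cong-All is n≤is f≥n≡0) (∑-zero is (λ _ → refl))

B-truncate : ∀ a (Y : NSym) γ n →
  (∀ i → n ℕ.≤ i → (H (a ℤ.+ + i) ·N F1perp i Y) γ ≡ 0ℚ) →
  B a Y γ ≡ (∑[ i ∈ range 0 n ] sgn i * (H (a ℤ.+ + i) ·N F1perp i Y) γ)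
B-truncate a Y γ n vanish≥n = begin
  ∑ (range 0 N) u              ≡⟨ sym (∑-range-truncate N n u (λ i N≤i → zero-term (H-+-·N-vanish a i _ γ N≤i))) ⟩
  ∑ (range 0 (N ℕ.+ n)) u      ≡⟨ cong (λ k → ∑ (range 0 k) u) (ℕ.+-comm N n) ⟩
  ∑ (range 0 (n ℕ.+ N)) u      ≡⟨ ∑-range-truncate n N u (λ i n≤i → zero-term (vanish≥n i n≤i)) ⟩
  ∑ (range 0 n) u              ∎
  where
  N = suc ∣ + sum γ ℤ.- a ∣
  u : ℕ → ℚ
  u i = sgn i * (H (a ℤ.+ + i) ·N F1perp i Y) γ
  zero-term : ∀ {i} → (H (a ℤ.+ + i) ·N F1perp i Y) γ ≡ 0ℚ → u i ≡ 0ℚ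
  zero-term {i} t≡0 = trans (cong (sgn i *_) t≡0) (ℚ.*-zeroʳ (sgn i))

det-shift : ∀ β C (φ : List ℤ → ℚ) → det (map (ℤ._- 1ℤ) β) (map (ℤ._+ 1ℤ) C) φ ≡ det β C φ
det-shift []      []      φ = refl
det-shift []      (_ ∷ _) φ = refl
det-shift (b ∷ β) C       φ = trans (expand-map (ℤ._+ 1ℤ) C _)
  (expand-cong C (λ c R → trans (det-shift β R _) (det-cong β R (λ w → cong (λ t → φ (t ∷ w)) (entry c)))))
  where
  entry : ∀ c → (b ℤ.- 1ℤ) ℤ.+ (c ℤ.+ 1ℤ) ≡ b ℤ.+ c
  entry = solve 2 (λ b c → (b :- con 1ℤ) :+ (c :+ con 1ℤ) := b :+ c) refl b
    where open ℤ-Solver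

-- The entries of det (rowsFrom 1 α) (consecutive 1ℤ m) are α_i - i + j.
rowsFrom : ℕ → List ℤ → List ℤ
rowsFrom j []       = []
rowsFrom j (a ∷ as) = (a ℤ.- + j) ∷ rowsFrom (suc j) as

rowsFrom-suc : ∀ j as → rowsFrom (suc j) as ≡ map (ℤ._- 1ℤ) (rowsFrom j as)
rowsFrom-suc j []       = refl
rowsFrom-suc j (a ∷ as) = cong₂ _∷_ (entry a j) (rowsFrom-suc (suc j) as)
  where
  entry : ∀ a j → a ℤ.- + suc j ≡ (a ℤ.- + j) ℤ.- 1ℤ
  entry a j = trans (cong (ℤ._-_ a) (sym (ℤ.pos-+ 1 j)))
                    (solve 2 (λ a j → a :- (con 1ℤ :+ j) := (a :- j) :- con 1ℤ) refl a (+ j))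
    where open ℤ-Solver

consecutive-suc : ∀ s m → consecutive (s ℤ.+ 1ℤ) m ≡ map (ℤ._+ 1ℤ) (consecutive s m)
consecutive-suc s zero    = refl
consecutive-suc s (suc m) = cong ((s ℤ.+ 1ℤ) ∷_) (consecutive-suc (s ℤ.+ 1ℤ) m)

lowerFirst-suc : ∀ i s m → lowerFirst i (s ℤ.+ 1ℤ) m ≡ map (ℤ._+ 1ℤ) (lowerFirst i s m)
lowerFirst-suc zero    s m       = consecutive-suc s m
lowerFirst-suc (suc i) s zero    = refl
lowerFirst-suc (suc i) s (suc m) = cong₂ _∷_ (solve 1 (λ s → (s :+ con 1ℤ) :- con 1ℤ := (s :- con 1ℤ) :+ con 1ℤ) refl s)
                                             (lowerFirst-suc i (s ℤ.+ 1ℤ) m)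
  where open ℤ-Solver

F1perp-det-Hword : ∀ i ρ C (Y : NSym) → Y ≈N (λ δ → det ρ C (λ w → Hword w δ)) →
  ∀ q → IsComposition q → F1perp i Y q ≡ (∑[ D ∈ lowerings i C ] det ρ D (λ w → Hword w q))
F1perp-det-Hword i ρ C Y Y≈det q q⁺ = begin
  F1perp i Y q                                              ≡⟨ F1perp-cong i Y≈det q ⟩
  F1perp i (λ δ → det ρ C (λ w → Hword w δ)) q              ≡⟨ F1perp-det i ρ C (λ δ w → Hword w δ) q ⟩
  det ρ C (λ w → F1perp i (Hword w) q)                      ≡⟨ det-cong ρ C (λ w → F1perp-Hword w i q q⁺) ⟩
  det ρ C (λ w → ∑[ w′ ∈ lowerings i w ] Hword w′ q)        ≡⟨ det-∑-lowerings ρ C i (λ w → Hword w q) ⟩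
  (∑[ D ∈ lowerings i C ] det ρ D (λ w → Hword w q))        ∎

-- H_{a+i} times the minor of rowsFrom 1 as at the columns lowerFirst i 1 m is the term
-- of the first-row expansion of rowsFrom 1 (a ∷ as) at column 1 + i.
H-·N-minor : ∀ a as i m γ →
  (H (a ℤ.+ + i) ·N (λ δ → det (rowsFrom 1 as) (lowerFirst i 1ℤ m) (λ w → Hword w δ))) γ
  ≡ det (rowsFrom 2 as) (lowerFirst i (1ℤ ℤ.+ 1ℤ) m) (λ w → Hword (((a ℤ.- + 1) ℤ.+ (1ℤ ℤ.+ + i)) ∷ w) γ)
H-·N-minor a as i m γ = begin
  (H (a ℤ.+ + i) ·N (λ δ → det ρ C (λ w → Hword w δ))) γ
    ≡⟨ ·N-detʳ (H (a ℤ.+ + i)) ρ C (λ δ w → Hword w δ) γ ⟩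
  det ρ C (λ w → Hword ((a ℤ.+ + i) ∷ w) γ)
    ≡⟨ det-cong ρ C (λ w → cong (λ t → Hword (t ∷ w) γ) (sym entry)) ⟩
  det ρ C φ
    ≡⟨ sym (det-shift ρ C φ) ⟩
  det (map (ℤ._- 1ℤ) ρ) (map (ℤ._+ 1ℤ) C) φ
    ≡⟨ sym (cong₂ (λ ρ′ C′ → det ρ′ C′ φ) (rowsFrom-suc 1 as) (lowerFirst-suc i 1ℤ m)) ⟩
  det (rowsFrom 2 as) (lowerFirst i (1ℤ ℤ.+ 1ℤ) m) φ ∎
  where
  ρ = rowsFrom 1 as
  C = lowerFirst i 1ℤ m
  φ : List ℤ → ℚ
  φ w = Hword (((a ℤ.- + 1) ℤ.+ (1ℤ ℤ.+ + i)) ∷ w) γ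
  entry : (a ℤ.- + 1) ℤ.+ (1ℤ ℤ.+ + i) ≡ a ℤ.+ + i
  entry = solve 2 (λ a i → (a :- con 1ℤ) :+ (con 1ℤ :+ i) := a :+ i) refl a (+ i)
    where open ℤ-Solver

-- 𝔹_a turns the determinant for α into its first-row expansion for a ∷ α: the i-th
-- term of 𝔹_a lowers the first i columns of the minor.
𝔖-det : ∀ m (α : Vec ℤ m) γ → IsComposition γ →
        𝔖 α γ ≡ det (rowsFrom 1 (toList α)) (consecutive 1ℤ m) (λ w → Hword w γ)
𝔖-det zero    []ᵥ        γ γ⁺ = refl
𝔖-det (suc m) (a ∷ᵥ α) γ γ⁺ = begin
  B a (𝔖 α) γ
    ≡⟨ B-truncate a (𝔖 α) γ (suc m) beyond-m ⟩
  (∑[ i ∈ range 0 (suc m) ] sgn i * (H (a ℤ.+ + i) ·N F1perp i (𝔖 α)) γ)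
    ≡⟨ ∑-cong-All (range 0 (suc m)) (range-< 0 (suc m)) (λ i i≤m → cong (sgn i *_) (term i i≤m)) ⟩
  (∑[ i ∈ range 0 (suc m) ] sgn i * f (1ℤ ℤ.+ + i) (lowerFirst i (1ℤ ℤ.+ 1ℤ) m))
    ≡⟨ sym (expand-consecutive m 1ℤ f) ⟩
  det (rowsFrom 1 (a ∷ toList α)) (consecutive 1ℤ (suc m)) (λ w → Hword w γ) ∎
  where
  ρ = rowsFrom 1 (toList α)
  C = consecutive 1ℤ m
  minor : List ℤ → NSym
  minor D δ = det ρ D (λ w → Hword w δ)
  H-·N-F1perp-𝔖 : ∀ i → (H (a ℤ.+ + i) ·N F1perp i (𝔖 α)) γ
                         ≡ (H (a ℤ.+ + i) ·N (λ δ → ∑ (lowerings i C) (λ D → minor D δ))) γ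
  H-·N-F1perp-𝔖 i = ·N-congʳ-≈N (H (a ℤ.+ + i)) (F1perp-det-Hword i ρ C (𝔖 α) (𝔖-det m α)) γ γ⁺
  beyond-m : ∀ i → suc m ℕ.≤ i → (H (a ℤ.+ + i) ·N F1perp i (𝔖 α)) γ ≡ 0ℚ
  beyond-m i m<i = trans (H-·N-F1perp-𝔖 i) (trans
    (·N-congʳ (H (a ℤ.+ + i)) (λ δ → cong (λ L → ∑ L (λ D → minor D δ))
      (lowerings-empty i C (subst (ℕ._< i) (sym (length-consecutive 1ℤ m)) m<i))) γ)
    (·N-zeroʳ (H (a ℤ.+ + i)) γ))
  f : ℤ → List ℤ → ℚ
  f c R = det (rowsFrom 2 (toList α)) R (λ w → Hword (((a ℤ.- + 1) ℤ.+ c) ∷ w) γ)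
  term : ∀ i → i ℕ.< suc m → (H (a ℤ.+ + i) ·N F1perp i (𝔖 α)) γ ≡ f (1ℤ ℤ.+ + i) (lowerFirst i (1ℤ ℤ.+ 1ℤ) m)
  term i (s≤s i≤m) = trans (H-·N-F1perp-𝔖 i) (trans
    (·N-congʳ (H (a ℤ.+ + i)) (λ δ → ∑-lowerings-consecutive i m 1ℤ (λ D → minor D δ)
                                       (λ D → det-alternating ρ D _) i≤m) γ)
    (H-·N-minor a (toList α) i m γ))

remove : ℕ → List ℕ → List ℕ
remove s = filterᵇ (λ u → not (s ≡ᵇ u))

Increasing : List ℕ → Set
Increasing = AllPairs ℕ._<_

remove-∷-≡ : ∀ s R → remove s (s ∷ R) ≡ remove s R
remove-∷-≡ s R rewrite ≡ᵇ-refl s = refl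

remove-∷-≢ : ∀ s r R → s ≢ r → remove s (r ∷ R) ≡ r ∷ remove s R
remove-∷-≢ s r R s≢r rewrite ≢⇒≡ᵇ-false s r s≢r = refl

remove-all-> : ∀ s R → All (s ℕ.<_) R → remove s R ≡ R
remove-all-> s []      []           = refl
remove-all-> s (u ∷ R) (s<u ∷ s<R) =
  trans (remove-∷-≢ s u R (λ s≡u → ℕ.<-irrefl s≡u s<u)) (cong (u ∷_) (remove-all-> s R s<R))

Increasing-remove : ∀ s {R} → Increasing R → Increasing (remove s R)
Increasing-remove s = AllPairs.filter⁺ (λ u → T? (not (s ≡ᵇ u)))

∈⇒≢-head : ∀ {s r R} → All (r ℕ.<_) R → s ∈ R → s ≢ r
∈⇒≢-head r<R s∈R s≡r = ℕ.<-irrefl (sym s≡r) (All.lookup r<R s∈R)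

length-remove : ∀ s R → Increasing R → s ∈ R → length R ≡ suc (length (remove s R))
length-remove s (s ∷ R) (s<R ∷ _) (here refl) =
  cong suc (sym (trans (cong length (remove-∷-≡ s R)) (cong length (remove-all-> s R s<R))))
length-remove s (r ∷ R) (r<R ∷ R↑) (there s∈R) =
  trans (cong suc (length-remove s R R↑ s∈R))
        (cong (suc ∘ length) (sym (remove-∷-≢ s r R (∈⇒≢-head r<R s∈R))))

countLess : List ℕ → ℕ → ℕ
countLess L t = length (filterᵇ (_<ᵇ t) L)

countLess-∷ : ∀ x L t → countLess (x ∷ L) t ≡ countLess (x ∷ []) t ℕ.+ countLess L t
countLess-∷ x L t with x <ᵇ t
... | true  = refl
... | false = refl

<⇒<ᵇ-false : ∀ {a b} → b ℕ.≤ a → (a <ᵇ b) ≡ false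
<⇒<ᵇ-false {a} {b} b≤a with a <ᵇ b in eq
... | false = refl
... | true  = ⊥-elim (ℕ.<⇒≱ (ℕ.<ᵇ⇒< a b (subst T (sym eq) tt)) b≤a)

<⇒<ᵇ-true : ∀ {a b} → a ℕ.< b → (a <ᵇ b) ≡ true
<⇒<ᵇ-true {a} {b} a<b with a <ᵇ b | ℕ.<⇒<ᵇ a<b
... | true | _ = refl

countLess-∷-≥ : ∀ x L t → t ℕ.≤ x → countLess (x ∷ L) t ≡ countLess L t
countLess-∷-≥ x L t t≤x rewrite countLess-∷ x L t | <⇒<ᵇ-false t≤x = refl

countLess-∷-< : ∀ x L t → x ℕ.< t → countLess (x ∷ L) t ≡ suc (countLess L t)
countLess-∷-< x L t x<t rewrite countLess-∷ x L t | <⇒<ᵇ-true x<t = refl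

countLess-∷-cong : ∀ x L L′ t → countLess L t ≡ countLess L′ t → countLess (x ∷ L) t ≡ countLess (x ∷ L′) t
countLess-∷-cong x L L′ t eq =
  trans (countLess-∷ x L t) (trans (cong (countLess (x ∷ []) t ℕ.+_) eq) (sym (countLess-∷ x L′ t)))

countLess-swap : ∀ a b L t → countLess (a ∷ b ∷ L) t ≡ countLess (b ∷ a ∷ L) t
countLess-swap a b L t = begin
  countLess (a ∷ b ∷ L) t                           ≡⟨ countLess-∷ a (b ∷ L) t ⟩
  countLess (a ∷ []) t ℕ.+ countLess (b ∷ L) t       ≡⟨ cong (countLess (a ∷ []) t ℕ.+_) (countLess-∷ b L t) ⟩
  countLess (a ∷ []) t ℕ.+ (countLess (b ∷ []) t ℕ.+ countLess L t)
    ≡⟨ solve 3 (λ x y z → x :+ (y :+ z) := y :+ (x :+ z)) refl (countLess (a ∷ []) t) (countLess (b ∷ []) t) _ ⟩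
  countLess (b ∷ []) t ℕ.+ (countLess (a ∷ []) t ℕ.+ countLess L t)
    ≡⟨ cong (countLess (b ∷ []) t ℕ.+_) (sym (countLess-∷ a L t)) ⟩
  countLess (b ∷ []) t ℕ.+ countLess (a ∷ L) t       ≡⟨ sym (countLess-∷ b (a ∷ L) t) ⟩
  countLess (b ∷ a ∷ L) t                           ∎
  where open ℕ-Solver

countLess-all-> : ∀ r R → All (r ℕ.<_) R → countLess R r ≡ 0
countLess-all-> r []      []           = refl
countLess-all-> r (u ∷ R) (r<u ∷ r<R) = trans (countLess-∷-≥ u R r (ℕ.<⇒≤ r<u)) (countLess-all-> r R r<R)

countLess-remove : ∀ s R t → Increasing R → s ∈ R → countLess R t ≡ countLess (s ∷ remove s R) t
countLess-remove s (s ∷ R) t (s<R ∷ _) (here refl) =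
  cong (λ L → countLess (s ∷ L) t) (sym (trans (remove-∷-≡ s R) (remove-all-> s R s<R)))
countLess-remove s (r ∷ R) t (r<R ∷ R↑) (there s∈R) = begin
  countLess (r ∷ R) t                ≡⟨ countLess-∷-cong r R _ t (countLess-remove s R t R↑ s∈R) ⟩
  countLess (r ∷ s ∷ remove s R) t   ≡⟨ countLess-swap r s (remove s R) t ⟩
  countLess (s ∷ r ∷ remove s R) t   ≡⟨ cong (λ L → countLess (s ∷ L) t) (sym (remove-∷-≢ s r R (∈⇒≢-head r<R s∈R))) ⟩
  countLess (s ∷ remove s (r ∷ R)) t ∎

countLess-remove-self : ∀ s R → countLess (remove s R) s ≡ countLess R s
countLess-remove-self s []      = refl
countLess-remove-self s (u ∷ R) with s ≡ᵇ u in eq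
... | true with ℕ.≡ᵇ⇒≡ s u (subst T (sym eq) tt)
...   | refl = trans (countLess-remove-self s R) (sym (countLess-∷-≥ s R s ℕ.≤-refl))
countLess-remove-self s (u ∷ R) | false =
  countLess-∷-cong u (remove s R) R s (countLess-remove-self s R)

sgn-+ : ∀ a b → sgn (a ℕ.+ b) ≡ sgn a * sgn b
sgn-+ zero    b = sym (ℚ.*-identityˡ (sgn b))
sgn-+ (suc a) b = trans (cong -_ (sgn-+ a b)) (ℚ.neg-distribˡ-* (sgn a) (sgn b))

sign-∷ : ∀ s σ R → (∀ t → countLess σ t ≡ countLess (remove s R) t) → sign (s ∷ σ) ≡ sgn (countLess R s) * sign σ
sign-∷ s σ R σ~R∖s = trans (cong (λ k → sgn (k ℕ.+ inversions σ)) (trans (σ~R∖s s) (countLess-remove-self s R)))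
                           (sgn-+ (countLess R s) (inversions σ))

arrangements : List ℕ → ℕ → List (List ℕ)
arrangements R zero    = [] ∷ []
arrangements R (suc n) = concatMap (λ s → map (s ∷_) (arrangements (remove s R) n)) R

arrangements-countLess : ∀ n R → Increasing R → length R ≡ n →
                         All (λ σ → ∀ t → countLess σ t ≡ countLess R t) (arrangements R n)
arrangements-countLess zero    []  _  _     = (λ t → refl) ∷ []
arrangements-countLess (suc n) R   R↑ |R|≡n = All.concat⁺ (All.map⁺ (All.tabulate starting-with))
  where
  starting-with : ∀ {s} → s ∈ R → All (λ σ → ∀ t → countLess σ t ≡ countLess R t)
                                       (map (s ∷_) (arrangements (remove s R) n))
  starting-with {s} s∈R = All.map⁺ (All.map
    (λ {σ} σ~R t → trans (countLess-∷-cong s σ _ t (σ~R t)) (sym (countLess-remove s R t R↑ s∈R)))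
    (arrangements-countLess n (remove s R) (Increasing-remove s R↑)
                            (ℕ.suc-injective (trans (sym (length-remove s R R↑ s∈R)) |R|≡n))))

-- Deleting s from an increasing R moves it past the countLess R s smaller entries.
expand-increasing : ∀ R (f : ℤ → List ℤ → ℚ) → Increasing R →
  expand (map +_ R) f ≡ (∑[ s ∈ R ] sgn (countLess R s) * f (+ s) (map +_ (remove s R)))
expand-increasing []      f _           = refl
expand-increasing (r ∷ R) f (r<R ∷ R↑) = begin
  f (+ r) (map +_ R) - expand (map +_ R) (λ c R′ → f c (+ r ∷ R′))
    ≡⟨ cong (_-_ (f (+ r) (map +_ R))) (expand-increasing R (λ c R′ → f c (+ r ∷ R′)) R↑) ⟩
  f (+ r) (map +_ R) - (∑[ s ∈ R ] sgn (countLess R s) * f (+ s) (+ r ∷ map +_ (remove s R)))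
    ≡⟨ cong₂ _+_ head-term (trans (sym (∑-neg R _)) (∑-cong-All R r<R later-term)) ⟩
  sgn (countLess (r ∷ R) r) * f (+ r) (map +_ (remove r (r ∷ R)))
    + (∑[ s ∈ R ] sgn (countLess (r ∷ R) s) * f (+ s) (map +_ (remove s (r ∷ R)))) ∎
  where
  head-term : f (+ r) (map +_ R) ≡ sgn (countLess (r ∷ R) r) * f (+ r) (map +_ (remove r (r ∷ R)))
  head-term = sym (begin
    sgn (countLess (r ∷ R) r) * f (+ r) (map +_ (remove r (r ∷ R)))
      ≡⟨ cong₂ (λ n L → sgn n * f (+ r) (map +_ L))
               (trans (countLess-∷-≥ r R r ℕ.≤-refl) (countLess-all-> r R r<R))
               (trans (remove-∷-≡ r R) (remove-all-> r R r<R)) ⟩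
    1ℚ * f (+ r) (map +_ R)
      ≡⟨ ℚ.*-identityˡ _ ⟩
    f (+ r) (map +_ R) ∎)
  later-term : ∀ s → r ℕ.< s → - (sgn (countLess R s) * f (+ s) (+ r ∷ map +_ (remove s R)))
                               ≡ sgn (countLess (r ∷ R) s) * f (+ s) (map +_ (remove s (r ∷ R)))
  later-term s r<s = trans (ℚ.neg-distribˡ-* (sgn (countLess R s)) _)
    (cong₂ (λ n L → sgn n * f (+ s) (map +_ L))
           (sym (countLess-∷-< r R s r<s)) (sym (remove-∷-≢ s r R (λ s≡r → ℕ.<-irrefl (sym s≡r) r<s))))

addRows : List ℤ → List ℕ → List ℤ
addRows = zipWith (λ b s → b ℤ.+ + s)

-- The first letter s of an arrangement picks the column of the first-row expansion.
∑-arrangements-det : ∀ ρ R (φ : List ℤ → ℚ) → Increasing R → length R ≡ length ρ →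
  (∑[ σ ∈ arrangements R (length ρ) ] sign σ * φ (addRows ρ σ)) ≡ det ρ (map +_ R) φ
∑-arrangements-det []      []  φ _  _     = trans (ℚ.+-identityʳ _) (ℚ.*-identityˡ (φ []))
∑-arrangements-det (b ∷ ρ) R   φ R↑ |R|≡n = begin
  ∑ (concatMap (λ s → map (s ∷_) (arrangements (remove s R) n)) R) F
    ≡⟨ ∑-concatMap R (λ s → map (s ∷_) (arrangements (remove s R) n)) F ⟩
  (∑[ s ∈ R ] ∑ (map (s ∷_) (arrangements (remove s R) n)) F)
    ≡⟨ ∑-cong-All R (All.tabulate (λ s∈R → s∈R)) starting-with ⟩
  (∑[ s ∈ R ] sgn (countLess R s) * det ρ (map +_ (remove s R)) (φ-from s))
    ≡⟨ sym (expand-increasing R (λ c R′ → det ρ R′ (λ w → φ ((b ℤ.+ c) ∷ w))) R↑) ⟩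
  det (b ∷ ρ) (map +_ R) φ ∎
  where
  n = length ρ
  F : List ℕ → ℚ
  F σ = sign σ * φ (addRows (b ∷ ρ) σ)
  φ-from : ℕ → List ℤ → ℚ
  φ-from s w = φ ((b ℤ.+ + s) ∷ w)
  starting-with : ∀ s → s ∈ R →
    ∑ (map (s ∷_) (arrangements (remove s R) n)) F ≡ sgn (countLess R s) * det ρ (map +_ (remove s R)) (φ-from s)
  starting-with s s∈R = begin
    ∑ (map (s ∷_) (arrangements R′ n)) F
      ≡⟨ ∑-map (arrangements R′ n) (s ∷_) F ⟩
    (∑[ σ ∈ arrangements R′ n ] F (s ∷ σ))
      ≡⟨ ∑-cong-All (arrangements R′ n) (arrangements-countLess n R′ R′↑ |R′|≡n) sign-∷-F ⟩
    (∑[ σ ∈ arrangements R′ n ] sgn (countLess R s) * (sign σ * φ-from s (addRows ρ σ)))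
      ≡⟨ ∑-*ˡ (arrangements R′ n) (sgn (countLess R s)) _ ⟩
    sgn (countLess R s) * (∑[ σ ∈ arrangements R′ n ] sign σ * φ-from s (addRows ρ σ))
      ≡⟨ cong (sgn (countLess R s) *_) (∑-arrangements-det ρ R′ (φ-from s) R′↑ |R′|≡n) ⟩
    sgn (countLess R s) * det ρ (map +_ R′) (φ-from s) ∎
    where
    R′ = remove s R
    R′↑ = Increasing-remove s R↑
    |R′|≡n : length R′ ≡ n
    |R′|≡n = ℕ.suc-injective (trans (sym (length-remove s R R↑ s∈R)) |R|≡n)
    sign-∷-F : ∀ σ → (∀ t → countLess σ t ≡ countLess R′ t) →
               F (s ∷ σ) ≡ sgn (countLess R s) * (sign σ * φ-from s (addRows ρ σ))
    sign-∷-F σ σ~R′ = trans (cong (_* φ-from s (addRows ρ σ)) (sign-∷ s σ R σ~R′))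
                            (ℚ.*-assoc (sgn (countLess R s)) (sign σ) _)

_∉ᵇ_ : ℕ → List ℕ → Bool
u ∉ᵇ []      = true
u ∉ᵇ (x ∷ X) = not (x ≡ᵇ u) ∧ u ∉ᵇ X

absent : ℕ → List ℕ → Bool
absent x σ = not (any (x ≡ᵇ_) σ)

disjoint : List ℕ → List ℕ → Bool
disjoint []      σ = true
disjoint (x ∷ X) σ = absent x σ ∧ disjoint X σ

disjoint-[] : ∀ X → disjoint X [] ≡ true
disjoint-[] []      = refl
disjoint-[] (x ∷ X) = disjoint-[] X

disjoint-∷ : ∀ X s σ → disjoint X (s ∷ σ) ≡ s ∉ᵇ X ∧ disjoint X σ
disjoint-∷ []      s σ = refl
disjoint-∷ (x ∷ X) s σ =
  trans (cong₂ _∧_ (not-∨ (x ≡ᵇ s) _) (disjoint-∷ X s σ)) (interchange (not (x ≡ᵇ s)) _ _ _)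
  where
  open CommutativeSemigroupProperties (CommutativeMonoid.commutativeSemigroup ∧-commutativeMonoid)
    using (interchange)
  not-∨ : ∀ a b → not (a ∨ b) ≡ not a ∧ not b
  not-∨ true  b = refl
  not-∨ false b = refl

distinct-disjoint-∷ : ∀ X s σ →
  (distinct (s ∷ σ) ∧ disjoint X (s ∷ σ)) ≡ (s ∉ᵇ X ∧ (distinct σ ∧ disjoint (s ∷ X) σ))
distinct-disjoint-∷ X s σ =
  trans (cong (λ t → (absent s σ ∧ distinct σ) ∧ t) (disjoint-∷ X s σ))
        (rearrange (absent s σ) (distinct σ) (s ∉ᵇ X) (disjoint X σ))
  where
  rearrange : ∀ a b c d → (a ∧ b) ∧ (c ∧ d) ≡ c ∧ (b ∧ (a ∧ d))
  rearrange true  true  c     d = refl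
  rearrange true  false true  d = refl
  rearrange true  false false d = refl
  rearrange false true  true  d = refl
  rearrange false true  false d = refl
  rearrange false false true  d = refl
  rearrange false false false d = refl

available : List ℕ → List ℕ → List ℕ
available X = filterᵇ (_∉ᵇ X)

available-∷ : ∀ s X U → available (s ∷ X) U ≡ remove s (available X U)
available-∷ s X []      = refl
available-∷ s X (u ∷ U) with u ∉ᵇ X
... | false with s ≡ᵇ u
...   | true  = available-∷ s X U
...   | false = available-∷ s X U
available-∷ s X (u ∷ U) | true with s ≡ᵇ u
...   | true  = available-∷ s X U
...   | false = cong (u ∷_) (available-∷ s X U)

-- Distinct words avoiding X are chosen one letter at a time from {1,…,m} ∖ X.
∑-seqs-arrangements : ∀ m k X (F : List ℕ → ℚ) →
  (∑[ σ ∈ seqs m k ] 𝟙 (distinct σ ∧ disjoint X σ) * F σ) ≡ ∑ (arrangements (available X (range 1 m)) k) F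
∑-seqs-arrangements m zero    X F =
  trans (cong (λ b → 𝟙 b * F [] + 0ℚ) (disjoint-[] X)) (cong (_+ 0ℚ) (ℚ.*-identityˡ (F [])))
∑-seqs-arrangements m (suc k) X F = begin
  ∑ (concatMap (λ s → map (s ∷_) (seqs m k)) U) W
    ≡⟨ ∑-concatMap U (λ s → map (s ∷_) (seqs m k)) W ⟩
  (∑[ s ∈ U ] ∑ (map (s ∷_) (seqs m k)) W)
    ≡⟨ ∑-cong U (λ s → trans (∑-map (seqs m k) (s ∷_) W)
                      (trans (∑-cong (seqs m k) (choose s)) (∑-*ˡ (seqs m k) (𝟙 (s ∉ᵇ X)) _))) ⟩
  (∑[ s ∈ U ] 𝟙 (s ∉ᵇ X) * (∑[ σ ∈ seqs m k ] 𝟙 (distinct σ ∧ disjoint (s ∷ X) σ) * F (s ∷ σ)))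
    ≡⟨ ∑-cong U (λ s → cong (𝟙 (s ∉ᵇ X) *_) (∑-seqs-arrangements m k (s ∷ X) (λ σ → F (s ∷ σ)))) ⟩
  (∑[ s ∈ U ] 𝟙 (s ∉ᵇ X) * ∑ (arrangements (available (s ∷ X) U) k) (λ σ → F (s ∷ σ)))
    ≡⟨ sym (∑-filterᵇ (_∉ᵇ X) U _) ⟩
  (∑[ s ∈ available X U ] ∑ (arrangements (available (s ∷ X) U) k) (λ σ → F (s ∷ σ)))
    ≡⟨ ∑-cong (available X U) (λ s → trans (cong (λ L → ∑ (arrangements L k) (λ σ → F (s ∷ σ))) (available-∷ s X U))
                                           (sym (∑-map (arrangements (remove s (available X U)) k) (s ∷_) F))) ⟩
  (∑[ s ∈ available X U ] ∑ (map (s ∷_) (arrangements (remove s (available X U)) k)) F)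
    ≡⟨ sym (∑-concatMap (available X U) (λ s → map (s ∷_) (arrangements (remove s (available X U)) k)) F) ⟩
  ∑ (arrangements (available X U) (suc k)) F ∎
  where
  U = range 1 m
  W : List ℕ → ℚ
  W σ = 𝟙 (distinct σ ∧ disjoint X σ) * F σ
  choose : ∀ s σ → W (s ∷ σ) ≡ 𝟙 (s ∉ᵇ X) * (𝟙 (distinct σ ∧ disjoint (s ∷ X) σ) * F (s ∷ σ))
  choose s σ = trans (cong (λ b → 𝟙 b * F (s ∷ σ)) (distinct-disjoint-∷ X s σ))
               (trans (cong (_* F (s ∷ σ)) (𝟙-∧ (s ∉ᵇ X) _)) (ℚ.*-assoc (𝟙 (s ∉ᵇ X)) _ _))

∑-permutations : ∀ m (F : List ℕ → ℚ) → ∑ (permutations m) F ≡ ∑ (arrangements (range 1 m) m) F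
∑-permutations m F = begin
  ∑ (filterᵇ distinct (seqs m m)) F
    ≡⟨ ∑-filterᵇ distinct (seqs m m) F ⟩
  (∑[ σ ∈ seqs m m ] 𝟙 (distinct σ) * F σ)
    ≡⟨ ∑-cong (seqs m m) (λ σ → cong (λ b → 𝟙 b * F σ) (sym (∧-identityʳ (distinct σ)))) ⟩
  (∑[ σ ∈ seqs m m ] 𝟙 (distinct σ ∧ disjoint [] σ) * F σ)
    ≡⟨ ∑-seqs-arrangements m m [] F ⟩
  ∑ (arrangements (available [] (range 1 m)) m) F
    ≡⟨ cong (λ L → ∑ (arrangements L m) F) (filterᵇ-true (range 1 m)) ⟩
  ∑ (arrangements (range 1 m) m) F ∎
  where
  filterᵇ-true : ∀ (U : List ℕ) → filterᵇ (λ _ → true) U ≡ U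
  filterᵇ-true []      = refl
  filterᵇ-true (u ∷ U) = cong (u ∷_) (filterᵇ-true U)

Hterm-Hword : ∀ j as σ γ → Hterm j as σ γ ≡ Hword (addRows (rowsFrom j as) σ) γ
Hterm-Hword j []       σ       γ = refl
Hterm-Hword j (a ∷ as) []      γ = refl
Hterm-Hword j (a ∷ as) (s ∷ σ) γ =
  trans (·N-congʳ (H (a ℤ.+ + s ℤ.- + j)) (λ q → Hterm-Hword (suc j) as σ q) γ)
        (cong (λ t → (H t ·N Hword (addRows (rowsFrom (suc j) as) σ)) γ)
              (solve 3 (λ a s j → a :+ s :- j := (a :- j) :+ s) refl a (+ s) (+ j)))
  where open ℤ-Solver

signedSum-∑ : ∀ (L : List (List ℕ)) (T : List ℕ → NSym) γ →
  foldr (λ σ acc → (sign σ •N T σ) +N acc) zeroN L γ ≡ (∑[ σ ∈ L ] sign σ * T σ γ)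
signedSum-∑ []      T γ = refl
signedSum-∑ (σ ∷ L) T γ = cong (_+_ (sign σ * T σ γ)) (signedSum-∑ L T γ)

length-rowsFrom : ∀ j as → length (rowsFrom j as) ≡ length as
length-rowsFrom j []       = refl
length-rowsFrom j (a ∷ as) = cong suc (length-rowsFrom (suc j) as)

length-range : ∀ a k → length (range a k) ≡ k
length-range a zero    = refl
length-range a (suc k) = cong suc (length-range (suc a) k)

Increasing-range : ∀ a k → Increasing (range a k)
Increasing-range a zero    = []
Increasing-range a (suc k) = range-≥ (suc a) k ∷ Increasing-range (suc a) k

map-+-range : ∀ a k → map +_ (range a k) ≡ consecutive (+ a) k
map-+-range a zero    = refl
map-+-range a (suc k) = cong (+ a ∷_) (trans (map-+-range (suc a) k) (cong (λ t → consecutive (+ t) k) (ℕ.+-comm 1 a)))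

detH-det : ∀ m (α : Vec ℤ m) γ → detH α γ ≡ det (rowsFrom 1 (toList α)) (consecutive 1ℤ m) (λ w → Hword w γ)
detH-det m α γ = begin
  detH α γ
    ≡⟨ signedSum-∑ (permutations m) (Hterm 1 (toList α)) γ ⟩
  (∑[ σ ∈ permutations m ] sign σ * Hterm 1 (toList α) σ γ)
    ≡⟨ ∑-cong (permutations m) (λ σ → cong (sign σ *_) (Hterm-Hword 1 (toList α) σ γ)) ⟩
  ∑ (permutations m) F
    ≡⟨ ∑-permutations m F ⟩
  ∑ (arrangements (range 1 m) m) F
    ≡⟨ cong (λ n → ∑ (arrangements (range 1 m) n) F) (sym |ρ|≡m) ⟩
  ∑ (arrangements (range 1 m) (length ρ)) F
    ≡⟨ ∑-arrangements-det ρ (range 1 m) (λ w → Hword w γ) (Increasing-range 1 m) (trans (length-range 1 m) (sym |ρ|≡m)) ⟩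
  det ρ (map +_ (range 1 m)) (λ w → Hword w γ)
    ≡⟨ cong (λ C → det ρ C (λ w → Hword w γ)) (map-+-range 1 m) ⟩
  det ρ (consecutive 1ℤ m) (λ w → Hword w γ) ∎
  where
  ρ = rowsFrom 1 (toList α)
  F : List ℕ → ℚ
  F σ = sign σ * Hword (addRows ρ σ) γ
  |ρ|≡m : length ρ ≡ m
  |ρ|≡m = trans (length-rowsFrom 1 (toList α)) (length-toList α)

theorem3p27 : (m : ℕ) (α : Vec ℤ m) → 𝔖 α ≈N detH α
theorem3p27 m α γ γ⁺ = trans (𝔖-det m α γ γ⁺) (sym (detH-det m α γ))
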